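{- Let $n\ge 2$, let $b\in\mathbb{Z}$, and let $\mathcal H\subseteq\mathbb{R}^n$ be the hyperplane $x_1=b$. Then the asymptotic density of visible points on $\mathcal H$ exists and equals \[\rho(\mathcal H)=\prod_{p\mid b}\left(1-\frac{1}{p^{n-1}}\right),\] where the product is over all primes dividing $b$ (so for $b=0$ it is the infinite product over all primes, equal to $1/\zeta(n-1)$, interpreted as $0$ when $n=2$).
   Context: A lattice point $\vec x=(x_1,\dots,x_n)\in\mathbb{Z}^n$ is visible if $\gcd(x_1,\dots,x_n)=1$. For $\Delta\subseteq\mathbb{R}^n$ and $r>0$, let $\Delta_1(r)=\Delta\cap[-r,r]^n\cap\mathbb{Z}^n$ and let $\Delta_0(r)$ be the set of visible points in $\Delta_1(r)$. The asymptotic density of visible points in $\Delta$ is $\rho(\Delta)=\lim_{r\to\infty}|\Delta_0(r)|/|\Delta_1(r)|$, when this limit exists. $\zeta$ is the Riemann zeta function. -}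

module Defs where

open import Data.Nat as ℕ using (ℕ; zero; suc; _^_; _∸_)
open import Data.Nat.GCD as NG using ()
open import Data.Nat.Divisibility using (_∣?_)
open import Data.Nat.Primality using (prime?)
open import Data.Integer as ℤ using (ℤ; +_)
open import Data.Rational as ℚ using (ℚ; 0ℚ; 1ℚ)
open import Data.Vec using (Vec; []; _∷_; toList)
open import Data.List using (List; []; _∷_; [_]; map; concatMap; filter; length; upTo; foldr)
open import Data.Empty using (⊥)
open import Relation.Binary.PropositionalEquality using (_≡_)
open import Relation.Nullary using (Dec; no)
open import Relation.Unary using (Decidable)

range : ℕ → List ℤ
range r = map (λ i → (+ i) ℤ.- (+ r)) (upTo (suc (2 ℕ.* r)))

box : (n : ℕ) → ℕ → List (Vec ℤ n)
box zero    r = [ [] ]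
box (suc n) r = concatMap (λ x → map (x ∷_) (box n r)) (range r)

OnHyperplane : ℤ → {n : ℕ} → Vec ℤ n → Set
OnHyperplane b []      = ⊥
OnHyperplane b (x ∷ _) = x ≡ b

onHyperplane? : (b : ℤ) {n : ℕ} → Decidable (OnHyperplane b {n})
onHyperplane? b []      = no (λ ())
onHyperplane? b (x ∷ _) = x ℤ.≟ b

gcdVec : {n : ℕ} → Vec ℤ n → ℕ
gcdVec v = foldr (λ x g → NG.gcd ℤ.∣ x ∣ g) 0 (toList v)

Visible : {n : ℕ} → Vec ℤ n → Set
Visible v = gcdVec v ≡ 1

visible? : {n : ℕ} → Decidable (Visible {n})
visible? v = gcdVec v ℕ.≟ 1

Δ₁ : (n : ℕ) → ℤ → ℕ → List (Vec ℤ n)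
Δ₁ n b r = filter (onHyperplane? b) (box n r)

Δ₀ : (n : ℕ) → ℤ → ℕ → List (Vec ℤ n)
Δ₀ n b r = filter visible? (Δ₁ n b r)

-- a / d as a rational, with the (irrelevant) convention a / 0 = 0
ratio : ℕ → ℕ → ℚ
ratio a zero    = 0ℚ
ratio a (suc d) = (+ a) ℚ./ suc d

densityRatio : (n : ℕ) → ℤ → ℕ → ℚ
densityRatio n b r = ratio (length (Δ₀ n b r)) (length (Δ₁ n b r))

-- partial product  ∏_{p ≤ P, p prime, p ∣ b} (1 - 1/p^(n-1))
-- (every prime divides 0, so for b = 0 this runs over all primes ≤ P)
primesDividingUpTo : ℤ → ℕ → List ℕ
primesDividingUpTo b P = filter (λ p → p ∣? ℤ.∣ b ∣) (filter prime? (upTo (suc P)))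

partialProduct : (n : ℕ) → ℤ → ℕ → ℚ
partialProduct n b P =
  foldr (λ p acc → (1ℚ ℚ.- ratio 1 (p ^ (n ∸ 1))) ℚ.* acc) 1ℚ (primesDividingUpTo b P)

{-# OPTIONS --safe #-}
-- Write the points of the hyperplane as (b, v) with v ∈ [-r, r]^m, m = n - 1; then (b, v) is visible iff
-- no prime divides both b and every coordinate of v. For a finite set S of primes call v S-rough if no
-- p ∈ S divides all its coordinates. The points of the box of radius r divisible by a prime q ∉ S are q
-- times the box of radius ⌊r/q⌋, so the number C(S, r) of S-rough points satisfies
-- C(q ∷ S, r) = C(S, r) - C(S, ⌊r/q⌋), and by induction on S their proportion tends to ∏_{p ∈ S} (1 - p^-m).
--
-- If b ≠ 0, visibility is S-roughness for S the primes dividing b, and this is the theorem.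
-- If b = 0 and m ≥ 2, the points that are rough for the primes ≤ P but not visible have a common divisor
-- d ∈ (P, r]; they make up at most Σ_{d > P} (2/d)^m ≤ 2^m/P of the box, and the primes beyond P change
-- the Euler product by at most Σ_{p > P} p^-m ≤ 1/P.
-- If b = 0 and m = 1, only ±1 are visible, and ∏_{p ≤ P} (1 - 1/p) → 0: for S the primes ≤ P the sets
-- k · (S-rough integers), 1 ≤ k ≤ P, are disjoint and the k-th has density ∏_{p ≤ P} (1 - 1/p) / k,
-- so ∏_{p ≤ P} (1 - 1/p) · Σ_{k ≤ P} 1/k ≤ 1, while Σ_{k ≤ 2^j} 1/k ≥ j/2.
module Submission where

module Counting where

  open import Data.Nat using (ℕ; suc; _+_; _*_; _≤_; z≤n; s≤s)
  import Data.Nat.Properties as ℕ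
  open import Data.Nat.ListAction using (sum)
  open import Data.List using (List; []; _∷_; map; _++_; length; filter; concatMap)
  import Data.List.Properties as List
  open import Data.List.Relation.Unary.All using (All; []; _∷_; tabulate)
  open import Data.List.Relation.Unary.Any using (Any; here; there; any?)
  open import Data.List.Relation.Unary.AllPairs using (AllPairs; []; _∷_)
  open import Data.Product using (_,_)
  open import Data.Sum using (inj₁; inj₂)
  open import Data.Empty using (⊥; ⊥-elim)
  open import Function using (_∘_)
  open import Level using (0ℓ)
  open import Relation.Binary.PropositionalEquality hiding ([_])
  open import Relation.Nullary using (yes; no)
  open import Relation.Unary using (Pred; Decidable; _≐_; _∪_)
  open import Relation.Unary.Properties using (_∩?_; _∪?_; ∁?)

  count : {A : Set} {P : Pred A 0ℓ} → Decidable P → List A → ℕ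
  count P? xs = length (filter P? xs)

  module _ {A : Set} where

    module _ {P : Pred A 0ℓ} (P? : Decidable P) where

      count-++ : ∀ xs ys → count P? (xs ++ ys) ≡ count P? xs + count P? ys
      count-++ xs ys = trans (cong length (List.filter-++ P? xs ys)) (List.length-++ (filter P? xs))

      count-all : ∀ xs → All P xs → count P? xs ≡ length xs
      count-all xs all = cong length (List.filter-all P? all)

      module _ {Q : Pred A 0ℓ} (Q? : Decidable Q) where

        count-cong : P ≐ Q → ∀ xs → count P? xs ≡ count Q? xs
        count-cong P≐Q xs = cong length (List.filter-≐ P? Q? P≐Q xs)

        count-mono : ∀ xs → All (λ x → P x → Q x) xs → count P? xs ≤ count Q? xs
        count-mono []       []         = z≤n
        count-mono (x ∷ xs) (P⇒Q ∷ hs) with P? x | Q? x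
        ... | yes p | yes _ = s≤s (count-mono xs hs)
        ... | yes p | no ¬q = ⊥-elim (¬q (P⇒Q p))
        ... | no _  | yes _ = ℕ.m≤n⇒m≤1+n (count-mono xs hs)
        ... | no _  | no _  = count-mono xs hs

        count-filter : ∀ xs → count P? (filter Q? xs) ≡ count (P? ∩? Q?) xs
        count-filter []       = refl
        count-filter (x ∷ xs) with Q? x
        ... | no _ with P? x
        ...   | yes _ = count-filter xs
        ...   | no _  = count-filter xs
        count-filter (x ∷ xs) | yes _ with P? x
        ...   | yes _ = cong suc (count-filter xs)
        ...   | no _  = count-filter xs

        count-partition : ∀ xs → count P? xs ≡ count (P? ∩? Q?) xs + count (P? ∩? ∁? Q?) xs
        count-partition []       = refl
        count-partition (x ∷ xs) with P? x | Q? x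
        ... | yes _ | yes _ = cong suc (count-partition xs)
        ... | yes _ | no _  = trans (cong suc (count-partition xs)) (sym (ℕ.+-suc _ _))
        ... | no _  | yes _ = count-partition xs
        ... | no _  | no _  = count-partition xs

        count-∪ : ∀ xs → count (P? ∪? Q?) xs ≤ count P? xs + count Q? xs
        count-∪ []       = z≤n
        count-∪ (x ∷ xs) with P? x | Q? x
        ... | yes _ | yes _ = s≤s (ℕ.≤-trans (count-∪ xs) (ℕ.+-monoʳ-≤ _ (ℕ.n≤1+n _)))
        ... | yes _ | no _  = s≤s (count-∪ xs)
        ... | no _  | yes _ = ℕ.≤-trans (s≤s (count-∪ xs)) (ℕ.≤-reflexive (sym (ℕ.+-suc _ _)))
        ... | no _  | no _  = count-∪ xs

        count-∪-disjoint : (∀ {x} → P x → Q x → ⊥) → ∀ xs → count (P? ∪? Q?) xs ≡ count P? xs + count Q? xs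
        count-∪-disjoint disjoint []       = refl
        count-∪-disjoint disjoint (x ∷ xs) with P? x | Q? x
        ... | yes p | yes q = ⊥-elim (disjoint p q)
        ... | yes _ | no _  = cong suc (count-∪-disjoint disjoint xs)
        ... | no _  | yes _ = trans (cong suc (count-∪-disjoint disjoint xs)) (sym (ℕ.+-suc _ _))
        ... | no _  | no _  = count-∪-disjoint disjoint xs

    module _ {B : Set} where

      filter-map : {P : Pred B 0ℓ} (P? : Decidable P) (f : A → B) (xs : List A) →
                   filter P? (map f xs) ≡ map f (filter (P? ∘ f) xs)
      filter-map P? f []       = refl
      filter-map P? f (x ∷ xs) with P? (f x)
      ... | yes _ = cong (f x ∷_) (filter-map P? f xs)
      ... | no _  = filter-map P? f xs

      count-map : {P : Pred B 0ℓ} (P? : Decidable P) (f : A → B) (xs : List A) →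
                  count P? (map f xs) ≡ count (P? ∘ f) xs
      count-map P? f xs = trans (cong length (filter-map P? f xs)) (List.length-map f (filter (P? ∘ f) xs))

      length-concatMap-const : (f : A → List B) (k : ℕ) → (∀ x → length (f x) ≡ k) →
                               ∀ xs → length (concatMap f xs) ≡ length xs * k
      length-concatMap-const f k len []       = refl
      length-concatMap-const f k len (x ∷ xs) =
        trans (List.length-++ (f x)) (cong₂ _+_ (len x) (length-concatMap-const f k len xs))

      private
        any-∷⇒∪ : ∀ (Q : B → Pred A 0ℓ) {d ds x} →
                  Any (λ d → Q d x) (d ∷ ds) → (Q d ∪ (λ x → Any (λ d → Q d x) ds)) x
        any-∷⇒∪ Q (here q)  = inj₁ q
        any-∷⇒∪ Q (there a) = inj₂ a

        ∪⇒any-∷ : ∀ (Q : B → Pred A 0ℓ) {d ds x} →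
                  (Q d ∪ (λ x → Any (λ d → Q d x) ds)) x → Any (λ d → Q d x) (d ∷ ds)
        ∪⇒any-∷ Q (inj₁ q) = here q
        ∪⇒any-∷ Q (inj₂ a) = there a

        count-any-[] : ∀ {Q : B → Pred A 0ℓ} (Q? : ∀ d → Decidable (Q d)) xs → 0 ≡ count (λ x → any? (λ d → Q? d x) []) xs
        count-any-[] Q? xs = sym (cong length (List.filter-none _ {xs} (tabulate (λ _ ()))))

      count-any : ∀ {Q : B → Pred A 0ℓ} (Q? : ∀ d → Decidable (Q d)) (ds : List B) (xs : List A) →
                  count (λ x → any? (λ d → Q? d x) ds) xs ≤ sum (map (λ d → count (Q? d) xs) ds)
      count-any Q? []       xs = ℕ.≤-reflexive (sym (count-any-[] Q? xs))
      count-any {Q} Q? (d ∷ ds) xs = begin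
        count (λ x → any? (λ d → Q? d x) (d ∷ ds)) xs
          ≡⟨ count-cong _ (Q? d ∪? (λ x → any? (λ d → Q? d x) ds)) (any-∷⇒∪ Q , ∪⇒any-∷ Q) xs ⟩
        count (Q? d ∪? (λ x → any? (λ d → Q? d x) ds)) xs
          ≤⟨ count-∪ (Q? d) _ xs ⟩
        count (Q? d) xs + count (λ x → any? (λ d → Q? d x) ds) xs
          ≤⟨ ℕ.+-monoʳ-≤ _ (count-any Q? ds xs) ⟩
        count (Q? d) xs + sum (map (λ d → count (Q? d) xs) ds) ∎
        where
        open ℕ.≤-Reasoning

      count-any-disjoint : ∀ {Q : B → Pred A 0ℓ} (Q? : ∀ d → Decidable (Q d)) (ds : List B) (xs : List A) →
        AllPairs (λ d d′ → ∀ {x} → Q d x → Q d′ x → ⊥) ds →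
        sum (map (λ d → count (Q? d) xs) ds) ≡ count (λ x → any? (λ d → Q? d x) ds) xs
      count-any-disjoint Q? []       xs []                  = count-any-[] Q? xs
      count-any-disjoint {Q} Q? (d ∷ ds) xs (d#ds ∷ disjoint) = begin
        count (Q? d) xs + sum (map (λ d → count (Q? d) xs) ds)
          ≡⟨ cong (count (Q? d) xs +_) (count-any-disjoint Q? ds xs disjoint) ⟩
        count (Q? d) xs + count (λ x → any? (λ d → Q? d x) ds) xs
          ≡⟨ count-∪-disjoint (Q? d) (λ x → any? (λ d → Q? d x) ds) d∩ds=∅ xs ⟨
        count (Q? d ∪? (λ x → any? (λ d → Q? d x) ds)) xs
          ≡⟨ count-cong _ (λ x → any? (λ d → Q? d x) (d ∷ ds)) (∪⇒any-∷ Q , any-∷⇒∪ Q) xs ⟩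
        count (λ x → any? (λ d → Q? d x) (d ∷ ds)) xs ∎
        where
        open ≡-Reasoning
        d∩ds=∅ : ∀ {x} → Q d x → Any (λ d → Q d x) ds → ⊥
        d∩ds=∅ = disjoint-any d#ds
          where
          disjoint-any : ∀ {ds x} → All (λ d′ → ∀ {x} → Q d x → Q d′ x → ⊥) ds →
                         Q d x → Any (λ d′ → Q d′ x) ds → ⊥
          disjoint-any (d#d′ ∷ _) q (here q′) = d#d′ q q′
          disjoint-any (_ ∷ d#ds) q (there a) = disjoint-any d#ds q a

module SymmetricBox where

  open import Defs
  open Counting
  open import Data.Nat as ℕ using (ℕ; zero; suc; _+_; _*_; _^_; _/_; _%_; _≤_; _<_; z≤n; NonZero)
  import Data.Nat.DivMod as ℕ
  import Data.Nat.Properties as ℕ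
  open import Data.Nat.Divisibility using (_∣_; _∣?_; divides)
  open import Data.Integer as ℤ using (ℤ; +_; -[1+_]; _⊖_; ∣_∣)
  import Data.Integer.Properties as ℤ
  open import Data.List using (List; []; _∷_; [_]; map; _++_; _∷ʳ_; upTo; applyUpTo; length; filter; concatMap)
  import Data.List.Properties as List
  open import Data.List.Relation.Unary.All as All using (All; []; _∷_)
  import Data.List.Relation.Unary.All.Properties as All
  open import Data.Vec as Vec using (Vec; []; _∷_)
  open import Data.Vec.Relation.Unary.All as VecAll using ([]; _∷_) renaming (All to VecAll)
  open import Data.Product using (_×_; _,_; proj₁; proj₂)
  open import Data.Sum using (inj₁; inj₂)
  open import Data.Unit using (tt)
  open import Data.Empty using (⊥-elim)
  open import Function using (_∘_; const)
  open import Level using (0ℓ)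
  open import Relation.Binary.PropositionalEquality hiding ([_])
  open import Relation.Nullary using (yes; no)
  open import Relation.Unary using (Pred; Decidable)

  interval : ℕ → List ℤ
  interval zero    = [ + 0 ]
  interval (suc r) = -[1+ r ] ∷ (interval r ∷ʳ + suc r)

  width : ℕ → ℕ
  width r = suc (r + r)

  applyUpTo-cong : ∀ {A : Set} {f g : ℕ → A} → (∀ i → f i ≡ g i) → ∀ n → applyUpTo f n ≡ applyUpTo g n
  applyUpTo-cong f≗g zero    = refl
  applyUpTo-cong f≗g (suc n) = cong₂ _∷_ (f≗g 0) (applyUpTo-cong (f≗g ∘ suc) n)

  applyUpTo-⊖≡interval : ∀ r → applyUpTo (_⊖ r) (width r) ≡ interval r
  applyUpTo-⊖≡interval zero    = refl
  applyUpTo-⊖≡interval (suc r) = cong (-[1+ r ] ∷_) (begin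
    applyUpTo (λ i → suc i ⊖ suc r) (suc r + suc r)
      ≡⟨ cong (applyUpTo (λ i → suc i ⊖ suc r)) (ℕ.+-suc (suc r) r) ⟩
    applyUpTo (λ i → suc i ⊖ suc r) (suc (width r))
      ≡⟨ List.applyUpTo-∷ʳ (λ i → suc i ⊖ suc r) (width r) ⟨
    applyUpTo (λ i → suc i ⊖ suc r) (width r) ∷ʳ (suc (width r) ⊖ suc r)
      ≡⟨ cong₂ _∷ʳ_ (trans (applyUpTo-cong (λ i → ℤ.[1+m]⊖[1+n]≡m⊖n i r) (width r))
                           (applyUpTo-⊖≡interval r))
                    top ⟩
    interval r ∷ʳ + suc r ∎)
    where
    open ≡-Reasoning
    top : suc (width r) ⊖ suc r ≡ + suc r
    top = begin
      suc (width r) ⊖ suc r ≡⟨ ℤ.[1+m]⊖[1+n]≡m⊖n (width r) r ⟩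
      width r ⊖ r           ≡⟨ ℤ.⊖-≥ (ℕ.m≤n⇒m≤1+n (ℕ.m≤m+n r r)) ⟩
      + (width r ℕ.∸ r)     ≡⟨ cong +_ (trans (ℕ.+-∸-assoc 1 (ℕ.m≤m+n r r)) (cong suc (ℕ.m+n∸m≡n r r))) ⟩
      + suc r               ∎

  range≡interval : ∀ r → range r ≡ interval r
  range≡interval r = begin
    map (λ i → + i ℤ.- + r) (upTo (suc (2 * r)))
      ≡⟨ List.map-upTo _ _ ⟩
    applyUpTo (λ i → + i ℤ.- + r) (suc (2 * r))
      ≡⟨ applyUpTo-cong (λ i → ℤ.[+m]-[+n]≡m⊖n i r) _ ⟩
    applyUpTo (_⊖ r) (suc (r + (r + 0)))
      ≡⟨ cong (λ k → applyUpTo (_⊖ r) (suc (r + k))) (ℕ.+-identityʳ r) ⟩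
    applyUpTo (_⊖ r) (width r)
      ≡⟨ applyUpTo-⊖≡interval r ⟩
    interval r ∎
    where open ≡-Reasoning

  length-interval : ∀ r → length (interval r) ≡ width r
  length-interval zero    = refl
  length-interval (suc r) = cong suc (begin
    length (interval r ++ [ + suc r ]) ≡⟨ List.length-++ (interval r) ⟩
    length (interval r) + 1            ≡⟨ cong (_+ 1) (length-interval r) ⟩
    width r + 1                        ≡⟨ ℕ.+-comm (width r) 1 ⟩
    suc (width r)                      ≡⟨ cong suc (ℕ.+-suc r r) ⟨
    suc r + suc r                      ∎)
    where open ≡-Reasoning

  interval-bounded : ∀ r → All (λ x → ∣ x ∣ ≤ r) (interval r)
  interval-bounded zero    = z≤n ∷ []
  interval-bounded (suc r) =
    ℕ.≤-refl ∷ All.++⁺ (All.map ℕ.m≤n⇒m≤1+n (interval-bounded r)) (ℕ.≤-refl ∷ [])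

  box-suc : ∀ m r → box (suc m) r ≡ concatMap (λ x → map (x ∷_) (box m r)) (interval r)
  box-suc m r = cong (concatMap (λ x → map (x ∷_) (box m r))) (range≡interval r)

  length-box : ∀ m r → length (box m r) ≡ width r ^ m
  length-box zero    r = refl
  length-box (suc m) r = begin
    length (box (suc m) r)
      ≡⟨ cong length (box-suc m r) ⟩
    length (concatMap (λ x → map (x ∷_) (box m r)) (interval r))
      ≡⟨ length-concatMap-const _ (width r ^ m) (λ x → trans (List.length-map (x ∷_) (box m r)) (length-box m r)) (interval r) ⟩
    length (interval r) * width r ^ m
      ≡⟨ cong (_* width r ^ m) (length-interval r) ⟩
    width r * width r ^ m ∎
    where open ≡-Reasoning

  box-bounded : ∀ m r → All (VecAll (λ x → ∣ x ∣ ≤ r)) (box m r)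
  box-bounded zero    r = [] ∷ []
  box-bounded (suc m) r rewrite box-suc m r = go (interval-bounded r)
    where
    go : ∀ {xs} → All (λ x → ∣ x ∣ ≤ r) xs →
         All (VecAll (λ x → ∣ x ∣ ≤ r)) (concatMap (λ x → map (x ∷_) (box m r)) xs)
    go []             = []
    go (x≤r ∷ xs≤r) = All.++⁺ (All.map⁺ (All.map (x≤r ∷_) (box-bounded m r))) (go xs≤r)

  filter-concatMap-∷ : ∀ {m} {P : Pred (Vec ℤ (suc m)) 0ℓ} {Q : Pred ℤ 0ℓ} {R : Pred (Vec ℤ m) 0ℓ}
    (P? : Decidable P) (Q? : Decidable Q) (R? : Decidable R) →
    (∀ {x v} → P (x ∷ v) → Q x × R v) → (∀ {x v} → Q x → R v → P (x ∷ v)) →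
    ∀ (vs : List (Vec ℤ m)) xs →
    filter P? (concatMap (λ x → map (x ∷_) vs) xs) ≡ concatMap (λ x → map (x ∷_) (filter R? vs)) (filter Q? xs)
  filter-concatMap-∷ P? Q? R? split join vs [] = refl
  filter-concatMap-∷ P? Q? R? split join vs (x ∷ xs) with Q? x
  ... | yes qx = trans (List.filter-++ P? (map (x ∷_) vs) _)
    (cong₂ _++_ (trans (filter-map P? (x ∷_) vs)
                       (cong (map (x ∷_)) (List.filter-≐ (P? ∘ (x ∷_)) R? (proj₂ ∘ split , join qx) vs)))
                (filter-concatMap-∷ P? Q? R? split join vs xs))
  ... | no ¬qx = trans (List.filter-++ P? (map (x ∷_) vs) _)
    (trans (cong (_++ _) (trans (filter-map P? (x ∷_) vs) (cong (map (x ∷_)) none)))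
           (filter-concatMap-∷ P? Q? R? split join vs xs))
    where none = List.filter-none (P? ∘ (x ∷_)) {vs} (All.tabulate (λ _ → ¬qx ∘ proj₁ ∘ split))

  -- Multiplication by q, by cases on x so that it computes on -[1+ k ] and + k.
  scaleℤ : ℕ → ℤ → ℤ
  scaleℤ q (+ n)    = + (q * n)
  scaleℤ q -[1+ n ] = ℤ.- (+ (q * suc n))

  ∣scaleℤ∣ : ∀ q x → ∣ scaleℤ q x ∣ ≡ q * ∣ x ∣
  ∣scaleℤ∣ q (+ n)    = refl
  ∣scaleℤ∣ q -[1+ n ] = ℤ.∣-i∣≡∣i∣ (+ (q * suc n))

  scale : ∀ {m} → ℕ → Vec ℤ m → Vec ℤ m
  scale q = Vec.map (scaleℤ q)

  infix 4 _∣ᵛ_ _∣ᵛ?_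

  _∣ᵛ_ : ∀ {m} → ℕ → Vec ℤ m → Set
  d ∣ᵛ v = VecAll (λ x → d ∣ ∣ x ∣) v

  _∣ᵛ?_ : ∀ {m} (d : ℕ) → Decidable (_∣ᵛ_ {m} d)
  d ∣ᵛ? v = VecAll.all? (λ x → d ∣? ∣ x ∣) v

  private
    multiple-between⇒≡ : ∀ q k s .{{_ : NonZero q}} → q ∣ s → q * k ≤ s → s < q * suc k → s ≡ q * k
    multiple-between⇒≡ q k s (divides c s≡cq) qk≤s s<qk+q =
      trans s≡cq (trans (cong (_* q) c≡k) (ℕ.*-comm k q))
      where
      s≡qc = trans s≡cq (ℕ.*-comm c q)
      c≡k : c ≡ k
      c≡k = ℕ.≤-antisym (ℕ.≤-pred (ℕ.*-cancelˡ-< q c (suc k) (subst (_< q * suc k) s≡qc s<qk+q)))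
                        (ℕ.*-cancelˡ-≤ q (subst (q * k ≤_) s≡qc qk≤s))

    *-suc≡suc⇒≤ : ∀ q k r .{{_ : NonZero q}} → q * suc k ≡ suc r → q * k ≤ r
    *-suc≡suc⇒≤ q k r eq = ℕ.≤-pred (begin-strict
      q * k     <⟨ ℕ.+-monoˡ-< (q * k) (ℕ.>-nonZero⁻¹ q) ⟩
      q + q * k ≡⟨ ℕ.*-suc q k ⟨
      q * suc k ≡⟨ eq ⟩
      suc r     ∎)
      where open ℕ.≤-Reasoning

  filter-∣-interval : ∀ q r k .{{_ : NonZero q}} → q * k ≤ r → r < q * suc k →
    filter (λ x → q ∣? ∣ x ∣) (interval r) ≡ map (scaleℤ q) (interval k)
  filter-∣-interval q zero k qk≤0 _ with ℕ.m*n≡0⇒m≡0∨n≡0 q (ℕ.n≤0⇒n≡0 qk≤0)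
  ... | inj₁ q≡0    = ⊥-elim (ℕ.≢-nonZero⁻¹ q q≡0)
  ... | inj₂ refl with q ∣? 0
  ...   | yes _   = cong (λ z → [ + z ]) (sym (ℕ.*-zeroʳ q))
  ...   | no q∤0  = ⊥-elim (q∤0 (divides 0 refl))
  filter-∣-interval q (suc r) k qk≤r r<qk+q with q ∣? suc r
  filter-∣-interval q (suc r) zero     qk≤r r<qk+q | yes q∣r =
    ⊥-elim (ℕ.1+n≢0 (trans (multiple-between⇒≡ q zero (suc r) q∣r qk≤r r<qk+q) (ℕ.*-zeroʳ q)))
  filter-∣-interval q (suc r) (suc k′) qk≤r r<qk+q | yes q∣r = begin
    -[1+ r ] ∷ filter D? (interval r ∷ʳ + suc r)
      ≡⟨ cong (-[1+ r ] ∷_) (List.filter-++ D? (interval r) [ + suc r ]) ⟩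
    -[1+ r ] ∷ (filter D? (interval r) ++ filter D? [ + suc r ])
      ≡⟨ cong₂ (λ xs ys → -[1+ r ] ∷ (xs ++ ys))
               (filter-∣-interval q r k′ (*-suc≡suc⇒≤ q k′ r (sym r≡)) (ℕ.≤-reflexive r≡))
               (List.filter-accept D? q∣r) ⟩
    -[1+ r ] ∷ (map (scaleℤ q) (interval k′) ∷ʳ + suc r)
      ≡⟨ cong₂ (λ a b → a ∷ (map (scaleℤ q) (interval k′) ∷ʳ b)) (cong (λ z → ℤ.- (+ z)) r≡) (cong +_ r≡) ⟩
    scaleℤ q -[1+ k′ ] ∷ (map (scaleℤ q) (interval k′) ∷ʳ scaleℤ q (+ suc k′))
      ≡⟨ cong (scaleℤ q -[1+ k′ ] ∷_) (List.map-++ (scaleℤ q) (interval k′) [ + suc k′ ]) ⟨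
    map (scaleℤ q) (interval (suc k′)) ∎
    where
    open ≡-Reasoning
    D? = λ x → q ∣? ∣ x ∣
    r≡ : suc r ≡ q * suc k′
    r≡ = multiple-between⇒≡ q (suc k′) (suc r) q∣r qk≤r r<qk+q
  filter-∣-interval q (suc r) k qk≤r r<qk+q | no q∤r = begin
    filter D? (interval r ∷ʳ + suc r)
      ≡⟨ List.filter-++ D? (interval r) [ + suc r ] ⟩
    filter D? (interval r) ++ filter D? [ + suc r ]
      ≡⟨ cong (filter D? (interval r) ++_) (List.filter-reject D? q∤r) ⟩
    filter D? (interval r) ++ []
      ≡⟨ List.++-identityʳ _ ⟩
    filter D? (interval r)
      ≡⟨ filter-∣-interval q r k qk≤r′ (ℕ.<-trans (ℕ.n<1+n r) r<qk+q) ⟩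
    map (scaleℤ q) (interval k) ∎
    where
    open ≡-Reasoning
    D? = λ x → q ∣? ∣ x ∣
    qk≤r′ : q * k ≤ r
    qk≤r′ = ℕ.≤-pred (ℕ.≤∧≢⇒< qk≤r (λ qk≡r → q∤r (divides k (trans (sym qk≡r) (ℕ.*-comm q k)))))

  filter-∣ᵛ-box : ∀ m q r k .{{_ : NonZero q}} → q * k ≤ r → r < q * suc k →
    filter (q ∣ᵛ?_) (box m r) ≡ map (scale q) (box m k)
  filter-∣ᵛ-box zero    q r k qk≤r r<qk+q = refl
  filter-∣ᵛ-box (suc m) q r k qk≤r r<qk+q = begin
    filter (q ∣ᵛ?_) (box (suc m) r)
      ≡⟨ cong (filter (q ∣ᵛ?_)) (box-suc m r) ⟩
    filter (q ∣ᵛ?_) (concatMap (λ x → map (x ∷_) (box m r)) (interval r))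
      ≡⟨ filter-concatMap-∷ (q ∣ᵛ?_) (λ x → q ∣? ∣ x ∣) (q ∣ᵛ?_) (λ { (a ∷ b) → a , b }) _∷_
                            (box m r) (interval r) ⟩
    concatMap (λ x → map (x ∷_) (filter (q ∣ᵛ?_) (box m r))) (filter (λ x → q ∣? ∣ x ∣) (interval r))
      ≡⟨ cong₂ (λ vs xs → concatMap (λ x → map (x ∷_) vs) xs)
               (filter-∣ᵛ-box m q r k qk≤r r<qk+q) (filter-∣-interval q r k qk≤r r<qk+q) ⟩
    concatMap (λ x → map (x ∷_) (map (scale q) (box m k))) (map (scaleℤ q) (interval k))
      ≡⟨ List.concatMap-map _ (scaleℤ q) (interval k) ⟩
    concatMap (λ z → map (scaleℤ q z ∷_) (map (scale q) (box m k))) (interval k)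
      ≡⟨ List.concatMap-cong (λ z → trans (sym (List.map-∘ (box m k))) (List.map-∘ (box m k))) (interval k) ⟩
    concatMap (λ z → map (scale q) (map (z ∷_) (box m k))) (interval k)
      ≡⟨ List.map-concatMap (scale q) _ (interval k) ⟨
    map (scale q) (concatMap (λ z → map (z ∷_) (box m k)) (interval k))
      ≡⟨ cong (map (scale q)) (box-suc m k) ⟨
    map (scale q) (box (suc m) k) ∎
    where open ≡-Reasoning

  quotient-bounds : ∀ r d .{{_ : NonZero d}} → d * (r / d) ≤ r × r < d * suc (r / d)
  quotient-bounds r d = subst (_≤ r) (ℕ.*-comm (r / d) d) (ℕ.m/n*n≤m r d) , (begin-strict
    r                   ≡⟨ ℕ.m≡m%n+[m/n]*n r d ⟩
    r % d + (r / d) * d <⟨ ℕ.+-monoˡ-< _ (ℕ.m%n<n r d) ⟩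
    d + (r / d) * d     ≡⟨ cong (λ x → d + x) (ℕ.*-comm (r / d) d) ⟩
    d + d * (r / d)     ≡⟨ ℕ.*-suc d (r / d) ⟨
    d * suc (r / d)     ∎)
    where open ℕ.≤-Reasoning

  count-∣ᵛ-box : ∀ m r d .{{_ : NonZero d}} → count (d ∣ᵛ?_) (box m r) ≡ width (r / d) ^ m
  count-∣ᵛ-box m r d = begin
    length (filter (d ∣ᵛ?_) (box m r))      ≡⟨ cong length (filter-∣ᵛ-box m d r (r / d) (proj₁ bounds) (proj₂ bounds)) ⟩
    length (map (scale d) (box m (r / d)))  ≡⟨ List.length-map (scale d) (box m (r / d)) ⟩
    length (box m (r / d))                  ≡⟨ length-box m (r / d) ⟩
    width (r / d) ^ m                       ∎
    where
    open ≡-Reasoning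
    bounds = quotient-bounds r d

  filter-≟-interval : ∀ b r → ∣ b ∣ ≤ r → filter (ℤ._≟ b) (interval r) ≡ [ b ]
  filter-≟-interval (+ zero)   zero    _ = refl
  filter-≟-interval (+ suc n)  zero    ()
  filter-≟-interval -[1+ n ]   zero    ()
  filter-≟-interval b          (suc r) b≤r with ℕ.m≤n⇒m<n∨m≡n b≤r
  ... | inj₁ b<r = begin
    filter (ℤ._≟ b) (-[1+ r ] ∷ (interval r ∷ʳ + suc r))
      ≡⟨ List.filter-reject (ℤ._≟ b) {x = -[1+ r ]} (λ eq → ℕ.<-irrefl (cong ∣_∣ (sym eq)) b<r) ⟩
    filter (ℤ._≟ b) (interval r ∷ʳ + suc r)
      ≡⟨ List.filter-++ (ℤ._≟ b) (interval r) _ ⟩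
    filter (ℤ._≟ b) (interval r) ++ filter (ℤ._≟ b) [ + suc r ]
      ≡⟨ cong₂ _++_ (filter-≟-interval b r (ℕ.≤-pred b<r))
                    (List.filter-reject (ℤ._≟ b) {x = + suc r} {xs = []} (λ eq → ℕ.<-irrefl (cong ∣_∣ (sym eq)) b<r)) ⟩
    [ b ] ∎
    where open ≡-Reasoning
  ... | inj₂ b≡r = at-end b b≡r
    where
    inner : ∀ b → ∣ b ∣ ≡ suc r → filter (ℤ._≟ b) (interval r ∷ʳ + suc r) ≡ filter (ℤ._≟ b) [ + suc r ]
    inner b b≡r = trans (List.filter-++ (ℤ._≟ b) (interval r) [ + suc r ])
      (cong (_++ filter (ℤ._≟ b) [ + suc r ]) (List.filter-none (ℤ._≟ b)
        (All.map (λ x≤r x≡b → ℕ.<-irrefl refl (subst (_≤ r) (trans (cong ∣_∣ x≡b) b≡r) x≤r)) (interval-bounded r))))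
    at-end : ∀ b → ∣ b ∣ ≡ suc r → filter (ℤ._≟ b) (-[1+ r ] ∷ (interval r ∷ʳ + suc r)) ≡ [ b ]
    at-end (+ .(suc r)) refl =
      trans (List.filter-reject (ℤ._≟ (+ suc r)) {x = -[1+ r ]} {xs = interval r ∷ʳ + suc r} (λ ()))
            (trans (inner (+ suc r) refl) (List.filter-accept (ℤ._≟ (+ suc r)) {x = + suc r} {xs = []} refl))
    at-end -[1+ .r ]    refl =
      trans (List.filter-accept (ℤ._≟ -[1+ r ]) {x = -[1+ r ]} {xs = interval r ∷ʳ + suc r} refl)
            (cong (-[1+ r ] ∷_) (trans (inner -[1+ r ] refl)
                                 (List.filter-reject (ℤ._≟ -[1+ r ]) {x = + suc r} {xs = []} (λ ()))))

  Δ₁≡ : ∀ m b r → ∣ b ∣ ≤ r → Δ₁ (suc m) b r ≡ map (b ∷_) (box m r)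
  Δ₁≡ m b r b≤r = begin
    filter (onHyperplane? b) (box (suc m) r)
      ≡⟨ cong (filter (onHyperplane? b)) (box-suc m r) ⟩
    filter (onHyperplane? b) (concatMap (λ x → map (x ∷_) (box m r)) (interval r))
      ≡⟨ filter-concatMap-∷ (onHyperplane? b) (ℤ._≟ b) (λ _ → yes tt) (_, tt) const (box m r) (interval r) ⟩
    concatMap (λ x → map (x ∷_) (filter (λ _ → yes tt) (box m r))) (filter (ℤ._≟ b) (interval r))
      ≡⟨ cong₂ (λ vs xs → concatMap (λ x → map (x ∷_) vs) xs)
               (List.filter-all (λ _ → yes tt) (All.tabulate _)) (filter-≟-interval b r b≤r) ⟩
    map (b ∷_) (box m r) ++ []
      ≡⟨ List.++-identityʳ _ ⟩
    map (b ∷_) (box m r) ∎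
    where open ≡-Reasoning

  length-Δ₁ : ∀ m b r → ∣ b ∣ ≤ r → length (Δ₁ (suc m) b r) ≡ width r ^ m
  length-Δ₁ m b r b≤r = trans (cong length (Δ₁≡ m b r b≤r)) (trans (List.length-map (b ∷_) (box m r)) (length-box m r))

  length-Δ₀ : ∀ m b r → ∣ b ∣ ≤ r → length (Δ₀ (suc m) b r) ≡ count (visible? ∘ (b ∷_)) (box m r)
  length-Δ₀ m b r b≤r = trans (cong (count visible?) (Δ₁≡ m b r b≤r)) (count-map visible? (b ∷_) (box m r))

module RoughPoints where

  open import Defs
  open Counting
  open SymmetricBox
  open import Data.Nat as ℕ using (ℕ; _+_; _*_; _/_; NonZero)
  import Data.Nat.Properties as ℕ
  open import Data.Nat.Divisibility using (_∣_; ∣-trans; n∣m*n)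
  open import Data.Nat.Primality using (Prime; euclidsLemma; prime⇒irreducible; ¬prime[1])
  open import Data.Integer using (ℤ)
  open import Data.List using (List; []; _∷_; map; filter)
  open import Data.List.Relation.Unary.All as All using (All; []; _∷_)
  open import Data.Vec as Vec using (Vec; []; _∷_)
  open import Data.Vec.Relation.Unary.All using ([]; _∷_)
  open import Data.Product using (_,_; proj₁; proj₂)
  open import Data.Sum using ([_,_])
  open import Data.Empty using (⊥-elim)
  open import Function using (_∘_; id)
  open import Relation.Binary.PropositionalEquality hiding ([_])
  open import Relation.Nullary using (¬_)
  open import Relation.Nullary.Decidable using (¬?)
  open import Relation.Unary using (Decidable)
  open import Relation.Unary.Properties using (_∩?_; ∁?)

  Rough : ∀ {m} → List ℕ → Vec ℤ m → Set
  Rough S v = All (λ p → ¬ p ∣ᵛ v) S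

  rough? : ∀ {m} (S : List ℕ) → Decidable (Rough {m} S)
  rough? S v = All.all? (λ p → ¬? (p ∣ᵛ? v)) S

  roughCount : ℕ → List ℕ → ℕ → ℕ
  roughCount m S r = count (rough? S) (box m r)

  private
    prime∣q*n⇒∣n : ∀ {p q n} → Prime p → Prime q → p ≢ q → p ∣ q * n → p ∣ n
    prime∣q*n⇒∣n {p} {q} {n} p-prime q-prime p≢q p∣qn =
      [ (λ p∣q → ⊥-elim ([ (λ p≡1 → ¬prime[1] (subst Prime p≡1 p-prime)) , p≢q ] (prime⇒irreducible q-prime p∣q))) , id ]
        (euclidsLemma q n p-prime p∣qn)

  ∣ᵛ-scale⁻ : ∀ {m p q} (v : Vec ℤ m) → Prime p → Prime q → p ≢ q → p ∣ᵛ scale q v → p ∣ᵛ v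
  ∣ᵛ-scale⁻         []       _ _ _ []               = []
  ∣ᵛ-scale⁻ {q = q} (x ∷ v) pp pq p≢q (p∣qx ∷ p∣qv) =
    prime∣q*n⇒∣n pp pq p≢q (subst (_ ∣_) (∣scaleℤ∣ q x) p∣qx) ∷ ∣ᵛ-scale⁻ v pp pq p≢q p∣qv

  ∣ᵛ-scale⁺ : ∀ {m p} q (v : Vec ℤ m) → p ∣ᵛ v → p ∣ᵛ scale q v
  ∣ᵛ-scale⁺ q []      []            = []
  ∣ᵛ-scale⁺ q (x ∷ v) (p∣x ∷ p∣v) =
    subst (_ ∣_) (sym (∣scaleℤ∣ q x)) (∣-trans p∣x (n∣m*n q)) ∷ ∣ᵛ-scale⁺ q v p∣v

  rough-scale⁺ : ∀ {m} q {S} (v : Vec ℤ m) → All Prime S → Prime q → All (q ≢_) S → Rough S v → Rough S (scale q v)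
  rough-scale⁺ q v []             _  []            []               = []
  rough-scale⁺ q v (pp ∷ primes) pq (q≢p ∷ q≢S) (p∤v ∷ S∤v) =
    (p∤v ∘ ∣ᵛ-scale⁻ v pp pq (q≢p ∘ sym)) ∷ rough-scale⁺ q v primes pq q≢S S∤v

  rough-scale⁻ : ∀ {m} q {S} (v : Vec ℤ m) → Rough S (scale q v) → Rough S v
  rough-scale⁻ q v = All.map (_∘ ∣ᵛ-scale⁺ q v)

  -- The points divisible by q of the box of radius r are q times the box of radius r / q,
  -- and since q ∉ S scaling by q preserves S-roughness.
  roughCount-∷ : ∀ m q S r .{{_ : NonZero q}} → All Prime S → Prime q → All (q ≢_) S →
    roughCount m (q ∷ S) r + roughCount m S (r / q) ≡ roughCount m S r
  roughCount-∷ m q S r primes q-prime q∉S = begin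
    roughCount m (q ∷ S) r + roughCount m S k
      ≡⟨ ℕ.+-comm (roughCount m (q ∷ S) r) _ ⟩
    roughCount m S k + roughCount m (q ∷ S) r
      ≡⟨ cong₂ _+_ multiples non-multiples ⟩
    count (rough? S ∩? (q ∣ᵛ?_)) (box m r) + count (rough? S ∩? ∁? (q ∣ᵛ?_)) (box m r)
      ≡⟨ count-partition (rough? S) (q ∣ᵛ?_) (box m r) ⟨
    roughCount m S r ∎
    where
    open ≡-Reasoning
    k = r / q
    non-multiples : roughCount m (q ∷ S) r ≡ count (rough? S ∩? ∁? (q ∣ᵛ?_)) (box m r)
    non-multiples = count-cong (rough? (q ∷ S)) _ ((λ { (a ∷ b) → b , a }) , (λ { (b , a) → a ∷ b })) (box m r)
    multiples : roughCount m S k ≡ count (rough? S ∩? (q ∣ᵛ?_)) (box m r)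
    multiples = begin
      count (rough? S) (box m k)
        ≡⟨ count-cong (rough? S) (rough? S ∘ scale q)
                      ((λ {v} → rough-scale⁺ q v primes q-prime q∉S) , (λ {v} → rough-scale⁻ q v)) (box m k) ⟩
      count (rough? S ∘ scale q) (box m k)
        ≡⟨ count-map (rough? S) (scale q) (box m k) ⟨
      count (rough? S) (map (scale q) (box m k))
        ≡⟨ cong (count (rough? S)) (filter-∣ᵛ-box m q r k (proj₁ (quotient-bounds r q)) (proj₂ (quotient-bounds r q))) ⟨
      count (rough? S) (filter (q ∣ᵛ?_) (box m r))
        ≡⟨ count-filter (rough? S) (q ∣ᵛ?_) (box m r) ⟩
      count (rough? S ∩? (q ∣ᵛ?_)) (box m r) ∎

module Visibility where

  open import Defs
  open SymmetricBox
  open RoughPoints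
  open import Data.Nat as ℕ using (ℕ; zero; suc; _+_; _∸_; _≤_; _<_; s≤s)
  import Data.Nat.Properties as ℕ
  open import Data.Nat.Divisibility using (_∣_; _∣?_; ∣-trans; m∣m*n; _∣0; ∣⇒≤; 0∣⇒≡0; ∣1⇒≡1)
  open import Data.Nat.GCD using (gcd; gcd[m,n]∣m; gcd[m,n]∣n; gcd-greatest; gcd-identityˡ)
  open import Data.Nat.Primality using (Prime; prime?; ¬prime[1]; prime[2])
  open import Data.Nat.Primality.Factorisation using (factorise)
  open import Data.Integer using (ℤ; +_; ∣_∣)
  open import Data.List using (List; []; _∷_; applyUpTo; upTo; filter)
  open import Data.List.Membership.Propositional using (_∈_; lose)
  import Data.List.Membership.Propositional.Properties as ∈
  open import Data.List.Relation.Unary.All as All using (All; []; _∷_)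
  open import Data.List.Relation.Unary.Any using (Any)
  open import Data.Vec using (Vec; []; _∷_)
  open import Data.Vec.Relation.Unary.All using ([]; _∷_) renaming (All to VecAll)
  open import Data.Product using (∃-syntax; _×_; _,_)
  open import Data.Empty using (⊥-elim)
  open import Relation.Binary.PropositionalEquality
  open import Relation.Nullary using (¬_; yes; no)
  open import Function using (_∘_)

  prime-divisor : ∀ {n} → n ≢ 0 → n ≢ 1 → ∃[ p ] Prime p × p ∣ n
  prime-divisor {zero}             n≢0 _ = ⊥-elim (n≢0 refl)
  prime-divisor {suc zero}         _ n≢1 = ⊥-elim (n≢1 refl)
  prime-divisor {n@(suc (suc _))} _ _   with factorise n
  ... | record { factors = []     ; isFactorisation = eq } = ⊥-elim (ℕ.1+n≢0 (ℕ.suc-injective eq))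
  ... | record { factors = p ∷ ps ; isFactorisation = eq ; factorsPrime = p-prime ∷ _ } =
    p , p-prime , subst (p ∣_) (sym eq) (m∣m*n _)

  ∣gcdVec⇒∣ᵛ : ∀ {m} d (v : Vec ℤ m) → d ∣ gcdVec v → d ∣ᵛ v
  ∣gcdVec⇒∣ᵛ d []      _   = []
  ∣gcdVec⇒∣ᵛ d (x ∷ v) d∣g =
    ∣-trans d∣g (gcd[m,n]∣m ∣ x ∣ (gcdVec v)) ∷ ∣gcdVec⇒∣ᵛ d v (∣-trans d∣g (gcd[m,n]∣n ∣ x ∣ (gcdVec v)))

  ∣ᵛ⇒∣gcdVec : ∀ {m} d (v : Vec ℤ m) → d ∣ᵛ v → d ∣ gcdVec v
  ∣ᵛ⇒∣gcdVec d []      _             = d ∣0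
  ∣ᵛ⇒∣gcdVec d (x ∷ v) (d∣x ∷ d∣v) = gcd-greatest d∣x (∣ᵛ⇒∣gcdVec d v d∣v)

  gcdVec≤ : ∀ {m r} (v : Vec ℤ m) → gcdVec v ≢ 0 → VecAll (λ x → ∣ x ∣ ≤ r) v → gcdVec v ≤ r
  gcdVec≤ []      g≢0 _ = ⊥-elim (g≢0 refl)
  gcdVec≤ (x ∷ v) g≢0 (x≤r ∷ v≤r) with ∣ x ∣ ℕ.≟ 0
  ... | yes x≡0 rewrite x≡0 =
    subst (_≤ _) (sym (gcd-identityˡ (gcdVec v))) (gcdVec≤ v (g≢0 ∘ trans (gcd-identityˡ (gcdVec v))) v≤r)
  ... | no  x≢0 = ℕ.≤-trans (∣⇒≤ {{ℕ.≢-nonZero x≢0}} (gcd[m,n]∣m ∣ x ∣ (gcdVec v))) x≤r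

  ∈-primesDividingUpTo⁺ : ∀ b P {p} → Prime p → p ∣ ∣ b ∣ → p ≤ P → p ∈ primesDividingUpTo b P
  ∈-primesDividingUpTo⁺ b P p-prime p∣b p≤P =
    ∈.∈-filter⁺ (_∣? ∣ b ∣) (∈.∈-filter⁺ prime? (∈.∈-upTo⁺ (s≤s p≤P)) p-prime) p∣b

  primesDividingUpTo-primeDivisors : ∀ b P → All (λ p → Prime p × p ∣ ∣ b ∣) (primesDividingUpTo b P)
  primesDividingUpTo-primeDivisors b P = All.tabulate λ p∈ →
    let p∈′ , p∣b = ∈.∈-filter⁻ (_∣? ∣ b ∣) {xs = filter prime? (upTo (suc P))} p∈
        _ , p-prime = ∈.∈-filter⁻ prime? {xs = upTo (suc P)} p∈′
    in p-prime , p∣b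

  visible⇒rough : ∀ {m} b {S} (v : Vec ℤ m) → All (λ p → Prime p × p ∣ ∣ b ∣) S → Visible (b ∷ v) → Rough S v
  visible⇒rough b v []                        vis = []
  visible⇒rough b v ((p-prime , p∣b) ∷ rest) vis =
    (λ p∣v → ¬prime[1] (subst Prime (∣1⇒≡1 (subst (_ ∣_) vis (gcd-greatest p∣b (∣ᵛ⇒∣gcdVec _ v p∣v)))) p-prime))
    ∷ visible⇒rough b v rest vis

  rough⇒visible : ∀ {m} b P (v : Vec ℤ m) → ∣ b ∣ ≢ 0 → ∣ b ∣ ≤ P →
                  Rough (primesDividingUpTo b P) v → Visible (b ∷ v)
  rough⇒visible b P v b≢0 b≤P rough with gcd ∣ b ∣ (gcdVec v) ℕ.≟ 1
  ... | yes g≡1 = g≡1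
  ... | no  g≢1 with prime-divisor (λ g≡0 → b≢0 (0∣⇒≡0 (subst (_∣ ∣ b ∣) g≡0 (gcd[m,n]∣m _ _)))) g≢1
  ...   | p , p-prime , p∣g =
    ⊥-elim (All.lookup rough p∈S (∣gcdVec⇒∣ᵛ p v (∣-trans p∣g (gcd[m,n]∣n ∣ b ∣ (gcdVec v)))))
    where
    p∣b = ∣-trans p∣g (gcd[m,n]∣m ∣ b ∣ (gcdVec v))
    p∈S = ∈-primesDividingUpTo⁺ b P p-prime p∣b (ℕ.≤-trans (∣⇒≤ {{ℕ.≢-nonZero b≢0}} p∣b) b≤P)

  largeDivisors : ℕ → ℕ → List ℕ
  largeDivisors P r = applyUpTo (λ i → suc P + i) (r ∸ P)

  ∈-largeDivisors⁺ : ∀ {P r d} → P < d → d ≤ r → d ∈ largeDivisors P r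
  ∈-largeDivisors⁺ {P} {r} {d} P<d d≤r = subst (_∈ largeDivisors P r) (ℕ.m+[n∸m]≡n P<d)
    (∈.∈-applyUpTo⁺ (λ i → suc P + i) (subst (_≤ r ∸ P) (ℕ.+-∸-assoc 1 P<d) (ℕ.∸-monoˡ-≤ P d≤r)))

  nonvisible-rough⇒largeDivisor : ∀ {m} P r (v : Vec ℤ m) → 2 ≤ P → VecAll (λ x → ∣ x ∣ ≤ r) v →
    Rough (primesDividingUpTo (+ 0) P) v → ¬ Visible (+ 0 ∷ v) → Any (_∣ᵛ v) (largeDivisors P r)
  nonvisible-rough⇒largeDivisor P r v 2≤P v≤r rough invisible =
    let p , p-prime , p∣g = prime-divisor g≢0 g≢1
        p∣v = ∣gcdVec⇒∣ᵛ p v p∣g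
        P<p = ℕ.≰⇒> (λ p≤P → small-prime-∤ p-prime p≤P p∣v)
        p≤r = ℕ.≤-trans (∣⇒≤ {{ℕ.≢-nonZero g≢0}} p∣g) (gcdVec≤ v g≢0 v≤r)
    in lose (∈-largeDivisors⁺ P<p p≤r) p∣v
    where
    small-prime-∤ : ∀ {p} → Prime p → p ≤ P → ¬ p ∣ᵛ v
    small-prime-∤ p-prime p≤P = All.lookup rough (∈-primesDividingUpTo⁺ (+ 0) P p-prime (_ ∣0) p≤P)
    g≢0 : gcdVec v ≢ 0
    g≢0 g≡0 = small-prime-∤ prime[2] 2≤P (∣gcdVec⇒∣ᵛ 2 v (subst (2 ∣_) (sym g≡0) (2 ∣0)))
    g≢1 : gcdVec v ≢ 1
    g≢1 g≡1 = invisible (trans (gcd-identityˡ (gcdVec v)) g≡1)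

module RationalArithmetic where

  open import Defs using (ratio)
  open import Data.Nat as ℕ using (ℕ; zero; suc; NonZero; z≤n; s≤s)
  import Data.Nat.Properties as ℕ
  open import Data.Integer as ℤ using (ℤ; +_; -[1+_]; +≤+; +<+)
  import Data.Integer.Properties as ℤ
  open import Data.Rational as ℚ using (ℚ; mkℚ; 0ℚ; 1ℚ; _/_; fromℚᵘ; _+_; _*_; _-_; -_; _≤_; _<_; ∣_∣)
  import Data.Rational.Properties as ℚ
  open import Data.Rational.Unnormalised as ℚᵘ using (ℚᵘ; mkℚᵘ; *≡*)
  import Data.Rational.Unnormalised.Properties as ℚᵘ
  open import Data.Rational.Solver using (module +-*-Solver)
  open +-*-Solver using (solve; _:=_; _:+_; _:*_; :-_; _:-_; con)
  open import Data.Product using (_×_; _,_; ∃-syntax; proj₁; proj₂)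
  open import Data.Sum using (inj₁; inj₂)
  open import Data.Empty using (⊥-elim)
  open import Data.Nat.ListAction using (sum)
  open import Data.List using (List; []; _∷_; map; foldr; filter; _++_; length)
  open import Data.List.Relation.Unary.All using (All; []; _∷_)
  open import Level using (0ℓ)
  open import Relation.Binary.PropositionalEquality
  open import Relation.Nullary using (yes; no)
  open import Relation.Unary using (Pred; Decidable)

  fromℕ : ℕ → ℚ
  fromℕ n = + n / 1

  private
    fromℚᵘ-+ : ∀ p q → fromℚᵘ (p ℚᵘ.+ q) ≡ fromℚᵘ p + fromℚᵘ q
    fromℚᵘ-+ p q = ℚ.toℚᵘ-injective (ℚᵘ.≃-trans (ℚ.toℚᵘ-fromℚᵘ _) (ℚᵘ.≃-sym (ℚᵘ.≃-trans
      (ℚ.toℚᵘ-homo-+ (fromℚᵘ p) (fromℚᵘ q)) (ℚᵘ.+-cong (ℚ.toℚᵘ-fromℚᵘ p) (ℚ.toℚᵘ-fromℚᵘ q)))))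

    fromℚᵘ-* : ∀ p q → fromℚᵘ (p ℚᵘ.* q) ≡ fromℚᵘ p * fromℚᵘ q
    fromℚᵘ-* p q = ℚ.toℚᵘ-injective (ℚᵘ.≃-trans (ℚ.toℚᵘ-fromℚᵘ _) (ℚᵘ.≃-sym (ℚᵘ.≃-trans
      (ℚ.toℚᵘ-homo-* (fromℚᵘ p) (fromℚᵘ q)) (ℚᵘ.*-cong (ℚ.toℚᵘ-fromℚᵘ p) (ℚ.toℚᵘ-fromℚᵘ q)))))

    toℚᵘ-fromℕ : ∀ n → ℚ.toℚᵘ (fromℕ n) ℚᵘ.≃ mkℚᵘ (+ n) 0
    toℚᵘ-fromℕ n = ℚ.toℚᵘ-fromℚᵘ (mkℚᵘ (+ n) 0)

  fromℕ-+ : ∀ a b → fromℕ (a ℕ.+ b) ≡ fromℕ a + fromℕ b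
  fromℕ-+ a b = trans (ℚ.fromℚᵘ-cong {mkℚᵘ (+ (a ℕ.+ b)) 0} {mkℚᵘ (+ a) 0 ℚᵘ.+ mkℚᵘ (+ b) 0} (*≡* eq))
                      (fromℚᵘ-+ (mkℚᵘ (+ a) 0) (mkℚᵘ (+ b) 0))
    where
    eq : + (a ℕ.+ b) ℤ.* + 1 ≡ (+ a ℤ.* + 1 ℤ.+ + b ℤ.* + 1) ℤ.* + 1
    eq = cong (ℤ._* + 1) (trans (ℤ.pos-+ a b) (sym (cong₂ ℤ._+_ (ℤ.*-identityʳ (+ a)) (ℤ.*-identityʳ (+ b)))))

  fromℕ-* : ∀ a b → fromℕ (a ℕ.* b) ≡ fromℕ a * fromℕ b
  fromℕ-* a b = trans (ℚ.fromℚᵘ-cong {mkℚᵘ (+ (a ℕ.* b)) 0} {mkℚᵘ (+ a) 0 ℚᵘ.* mkℚᵘ (+ b) 0} (*≡* eq))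
                      (fromℚᵘ-* (mkℚᵘ (+ a) 0) (mkℚᵘ (+ b) 0))
    where
    eq : + (a ℕ.* b) ℤ.* + 1 ≡ (+ a ℤ.* + b) ℤ.* + 1
    eq = cong (ℤ._* + 1) (ℤ.pos-* a b)

  fromℕ-suc : ∀ n → fromℕ (suc n) ≡ fromℕ n + 1ℚ
  fromℕ-suc n = trans (cong fromℕ (ℕ.+-comm 1 n)) (fromℕ-+ n 1)

  fromℕ-mono-≤ : ∀ {a b} → a ℕ.≤ b → fromℕ a ≤ fromℕ b
  fromℕ-mono-≤ {a} {b} a≤b = ℚ.toℚᵘ-cancel-≤ (ℚᵘ.≤-respʳ-≃ (ℚᵘ.≃-sym (toℚᵘ-fromℕ b))
    (ℚᵘ.≤-respˡ-≃ (ℚᵘ.≃-sym (toℚᵘ-fromℕ a)) (ℚᵘ.*≤* (ℤ.*-monoʳ-≤-nonNeg (+ 1) (+≤+ a≤b)))))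

  fromℕ-mono-< : ∀ {a b} → a ℕ.< b → fromℕ a < fromℕ b
  fromℕ-mono-< {a} {b} a<b = ℚ.toℚᵘ-cancel-< (ℚᵘ.<-respʳ-≃ (ℚᵘ.≃-sym (toℚᵘ-fromℕ b))
    (ℚᵘ.<-respˡ-≃ (ℚᵘ.≃-sym (toℚᵘ-fromℕ a)) (ℚᵘ.*<* (ℤ.*-monoʳ-<-pos (+ 1) (+<+ a<b)))))

  0≤fromℕ : ∀ n → 0ℚ ≤ fromℕ n
  0≤fromℕ n = fromℕ-mono-≤ {0} {n} z≤n

  0<fromℕ : ∀ n .{{_ : NonZero n}} → 0ℚ < fromℕ n
  0<fromℕ n = fromℕ-mono-< {0} {n} (ℕ.>-nonZero⁻¹ n)

  *-monoˡ-≤-0≤ : ∀ {r p q} → 0ℚ ≤ r → p ≤ q → p * r ≤ q * r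
  *-monoˡ-≤-0≤ {r} 0≤r = ℚ.*-monoʳ-≤-nonNeg r {{ℚ.nonNegative 0≤r}}

  *-monoʳ-≤-0≤ : ∀ {r p q} → 0ℚ ≤ r → p ≤ q → r * p ≤ r * q
  *-monoʳ-≤-0≤ {r} 0≤r = ℚ.*-monoˡ-≤-nonNeg r {{ℚ.nonNegative 0≤r}}

  *-monoˡ-<-0< : ∀ {r p q} → 0ℚ < r → p < q → p * r < q * r
  *-monoˡ-<-0< {r} 0<r = ℚ.*-monoˡ-<-pos r {{ℚ.positive 0<r}}

  *-monoʳ-<-0< : ∀ {r p q} → 0ℚ < r → p < q → r * p < r * q
  *-monoʳ-<-0< {r} 0<r = ℚ.*-monoʳ-<-pos r {{ℚ.positive 0<r}}

  *-cancelˡ-≤-0< : ∀ {r p q} → 0ℚ < r → r * p ≤ r * q → p ≤ q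
  *-cancelˡ-≤-0< {r} 0<r = ℚ.*-cancelˡ-≤-pos r {{ℚ.positive 0<r}}

  0≤* : ∀ {p q} → 0ℚ ≤ p → 0ℚ ≤ q → 0ℚ ≤ p * q
  0≤* {p} {q} 0≤p 0≤q = subst (_≤ p * q) (ℚ.*-zeroˡ q) (*-monoˡ-≤-0≤ 0≤q 0≤p)

  0<* : ∀ {p q} → 0ℚ < p → 0ℚ < q → 0ℚ < p * q
  0<* {p} {q} 0<p 0<q = subst (_< p * q) (ℚ.*-zeroˡ q) (*-monoˡ-<-0< 0<q 0<p)

  0<1 : 0ℚ < 1ℚ
  0<1 = ℚ.positive⁻¹ 1ℚ

  0≤1 : 0ℚ ≤ 1ℚ
  0≤1 = ℚ.<⇒≤ 0<1

  p≤1⇒0≤1-p : ∀ {p} → p ≤ 1ℚ → 0ℚ ≤ 1ℚ - p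
  p≤1⇒0≤1-p {p} p≤1 = subst (_≤ 1ℚ - p) (ℚ.+-inverseʳ p) (ℚ.+-monoˡ-≤ (- p) p≤1)

  0≤p⇒1-p≤1 : ∀ {p} → 0ℚ ≤ p → 1ℚ - p ≤ 1ℚ
  0≤p⇒1-p≤1 {p} 0≤p = subst (1ℚ - p ≤_) (ℚ.+-identityʳ 1ℚ) (ℚ.+-monoʳ-≤ 1ℚ (ℚ.neg-antimono-≤ 0≤p))

  ratio-*-fromℕ : ∀ a n .{{_ : NonZero n}} → ratio a n * fromℕ n ≡ fromℕ a
  ratio-*-fromℕ a (suc d) = ℚ.toℚᵘ-injective (ℚᵘ.≃-trans (ℚ.toℚᵘ-homo-* (ratio a (suc d)) (fromℕ (suc d)))
    (ℚᵘ.≃-trans (ℚᵘ.*-cong (ℚ.toℚᵘ-fromℚᵘ (mkℚᵘ (+ a) d)) (toℚᵘ-fromℕ (suc d)))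
    (ℚᵘ.≃-trans cancel (ℚᵘ.≃-sym (toℚᵘ-fromℕ a)))))
    where
    cancel : mkℚᵘ (+ a) d ℚᵘ.* mkℚᵘ (+ suc d) 0 ℚᵘ.≃ mkℚᵘ (+ a) 0
    cancel = *≡* (trans (ℤ.*-identityʳ (+ a ℤ.* + suc d)) (cong (λ z → + a ℤ.* + z) (sym (ℕ.*-identityʳ (suc d)))))

  fromℕ-*-ratio1 : ∀ n .{{_ : NonZero n}} → fromℕ n * ratio 1 n ≡ 1ℚ
  fromℕ-*-ratio1 n = trans (ℚ.*-comm (fromℕ n) (ratio 1 n)) (ratio-*-fromℕ 1 n)

  ratio-unique : ∀ {x} a n .{{_ : NonZero n}} → x * fromℕ n ≡ fromℕ a → x ≡ ratio a n
  ratio-unique {x} a n x*n≡a = begin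
    x                                  ≡⟨ ℚ.*-identityʳ x ⟨
    x * 1ℚ                             ≡⟨ cong (x *_) (fromℕ-*-ratio1 n) ⟨
    x * (fromℕ n * ratio 1 n)          ≡⟨ ℚ.*-assoc x _ _ ⟨
    (x * fromℕ n) * ratio 1 n          ≡⟨ cong (_* ratio 1 n) (trans x*n≡a (sym (ratio-*-fromℕ a n))) ⟩
    (ratio a n * fromℕ n) * ratio 1 n  ≡⟨ ℚ.*-assoc (ratio a n) _ _ ⟩
    ratio a n * (fromℕ n * ratio 1 n)  ≡⟨ cong (ratio a n *_) (fromℕ-*-ratio1 n) ⟩
    ratio a n * 1ℚ                     ≡⟨ ℚ.*-identityʳ _ ⟩
    ratio a n                          ∎
    where open ≡-Reasoning

  0≤ratio : ∀ a n → 0ℚ ≤ ratio a n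
  0≤ratio a zero    = ℚ.≤-refl
  0≤ratio a (suc d) = ℚ.nonNegative⁻¹ (ratio a (suc d)) {{ℚ.normalize-nonNeg a (suc d)}}

  0<ratio1 : ∀ n .{{_ : NonZero n}} → 0ℚ < ratio 1 n
  0<ratio1 (suc d) = ℚ.positive⁻¹ (ratio 1 (suc d)) {{ℚ.normalize-pos 1 (suc d)}}

  ratio1-antitone : ∀ {a b} .{{_ : NonZero a}} → a ℕ.≤ b → ratio 1 b ≤ ratio 1 a
  ratio1-antitone {a} {b} a≤b = begin
    ratio 1 b                              ≡⟨ ℚ.*-identityʳ _ ⟨
    ratio 1 b * 1ℚ                         ≡⟨ cong (ratio 1 b *_) (fromℕ-*-ratio1 a) ⟨
    ratio 1 b * (fromℕ a * ratio 1 a)      ≡⟨ ℚ.*-assoc (ratio 1 b) _ _ ⟨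
    (ratio 1 b * fromℕ a) * ratio 1 a      ≤⟨ *-monoˡ-≤-0≤ (0≤ratio 1 a) (*-monoʳ-≤-0≤ (0≤ratio 1 b) (fromℕ-mono-≤ a≤b)) ⟩
    (ratio 1 b * fromℕ b) * ratio 1 a      ≡⟨ cong (_* ratio 1 a) (ratio-*-fromℕ 1 b) ⟩
    1ℚ * ratio 1 a                         ≡⟨ ℚ.*-identityˡ _ ⟩
    ratio 1 a                              ∎
    where
    open ℚ.≤-Reasoning
    instance _ = ℕ.>-nonZero (ℕ.<-≤-trans (ℕ.>-nonZero⁻¹ a) a≤b)

  ratio1≤1 : ∀ n → ratio 1 n ≤ 1ℚ
  ratio1≤1 zero    = 0≤1
  ratio1≤1 (suc d) = ratio1-antitone {1} {suc d} (s≤s z≤n)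

  infixr 8 _^_

  _^_ : ℚ → ℕ → ℚ
  x ^ zero  = 1ℚ
  x ^ suc m = x * x ^ m

  ^-distribʳ-* : ∀ x y m → (x * y) ^ m ≡ x ^ m * y ^ m
  ^-distribʳ-* x y zero    = refl
  ^-distribʳ-* x y (suc m) = trans (cong ((x * y) *_) (^-distribʳ-* x y m)) (interchange x y (x ^ m) (y ^ m))
    where
    interchange : ∀ a b c d → (a * b) * (c * d) ≡ (a * c) * (b * d)
    interchange = solve 4 (λ a b c d → ((a :* b) :* (c :* d)) := ((a :* c) :* (b :* d))) refl

  1^n≡1 : ∀ n → 1ℚ ^ n ≡ 1ℚ
  1^n≡1 zero    = refl
  1^n≡1 (suc n) = trans (ℚ.*-identityˡ _) (1^n≡1 n)

  fromℕ-^ : ∀ a m → fromℕ (a ℕ.^ m) ≡ fromℕ a ^ m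
  fromℕ-^ a zero    = refl
  fromℕ-^ a (suc m) = trans (fromℕ-* a (a ℕ.^ m)) (cong (fromℕ a *_) (fromℕ-^ a m))

  0≤^ : ∀ {x} m → 0ℚ ≤ x → 0ℚ ≤ x ^ m
  0≤^ zero    _   = 0≤1
  0≤^ (suc m) 0≤x = 0≤* 0≤x (0≤^ m 0≤x)

  ^-monoˡ-≤ : ∀ {x y} m → 0ℚ ≤ x → x ≤ y → x ^ m ≤ y ^ m
  ^-monoˡ-≤ zero    _   _   = ℚ.≤-refl
  ^-monoˡ-≤ (suc m) 0≤x x≤y =
    ℚ.≤-trans (*-monoˡ-≤-0≤ (0≤^ m 0≤x) x≤y) (*-monoʳ-≤-0≤ (ℚ.≤-trans 0≤x x≤y) (^-monoˡ-≤ m 0≤x x≤y))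

  ^≤1 : ∀ {x} m → 0ℚ ≤ x → x ≤ 1ℚ → x ^ m ≤ 1ℚ
  ^≤1 {x} m 0≤x x≤1 = subst (x ^ m ≤_) (1^n≡1 m) (^-monoˡ-≤ m 0≤x x≤1)

  ratio1-^ : ∀ n m .{{_ : NonZero n}} → ratio 1 n ^ m ≡ ratio 1 (n ℕ.^ m)
  ratio1-^ n m = ratio-unique 1 (n ℕ.^ m) {{ℕ.m^n≢0 n m}} (begin
    ratio 1 n ^ m * fromℕ (n ℕ.^ m) ≡⟨ cong (ratio 1 n ^ m *_) (fromℕ-^ n m) ⟩
    ratio 1 n ^ m * fromℕ n ^ m     ≡⟨ ^-distribʳ-* _ _ m ⟨
    (ratio 1 n * fromℕ n) ^ m       ≡⟨ cong (_^ m) (ratio-*-fromℕ 1 n) ⟩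
    1ℚ ^ m                          ≡⟨ 1^n≡1 m ⟩
    1ℚ                              ∎)
    where open ≡-Reasoning

  ∣p∣≤c : ∀ {p c} → p ≤ c → - p ≤ c → ∣ p ∣ ≤ c
  ∣p∣≤c {p} p≤c -p≤c with ℚ.∣p∣≡p∨∣p∣≡-p p
  ... | inj₁ ∣p∣≡p  = subst (_≤ _) (sym ∣p∣≡p) p≤c
  ... | inj₂ ∣p∣≡-p = subst (_≤ _) (sym ∣p∣≡-p) -p≤c

  ∣p∣≤1 : ∀ {p} → 0ℚ ≤ p → p ≤ 1ℚ → ∣ p ∣ ≤ 1ℚ
  ∣p∣≤1 0≤p p≤1 = subst (_≤ 1ℚ) (sym (ℚ.0≤p⇒∣p∣≡p 0≤p)) p≤1

  p≤∣p∣ : ∀ p → p ≤ ∣ p ∣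
  p≤∣p∣ p with ℚ.∣p∣≡p∨∣p∣≡-p p
  ... | inj₁ ∣p∣≡p  = ℚ.≤-reflexive (sym ∣p∣≡p)
  ... | inj₂ ∣p∣≡-p = ℚ.≤-trans p≤0 (ℚ.0≤∣p∣ p)
    where
    neg-involutive : ∀ p → - (- p) ≡ p
    neg-involutive = solve 1 (λ p → (:- (:- p)) := p) refl
    p≤0 : p ≤ 0ℚ
    p≤0 = subst (_≤ 0ℚ) (trans (cong -_ ∣p∣≡-p) (neg-involutive p)) (ℚ.neg-antimono-≤ (ℚ.0≤∣p∣ p))

  ∣p-q∣≤c : ∀ {p q c} → p < q + c → q < p + c → ∣ p - q ∣ ≤ c
  ∣p-q∣≤c {p} {q} {c} p<q+c q<p+c = ∣p∣≤c
    (ℚ.<⇒≤ (subst (p - q <_) (cancel q c) (ℚ.+-monoˡ-< (- q) p<q+c)))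
    (ℚ.<⇒≤ (subst₂ _<_ (swap p q) (cancel p c) (ℚ.+-monoˡ-< (- p) q<p+c)))
    where
    cancel : ∀ q c → (q + c) - q ≡ c
    cancel = solve 2 (λ q c → ((q :+ c) :- q) := c) refl
    swap : ∀ p q → q - p ≡ - (p - q)
    swap = solve 2 (λ p q → (q :- p) := (:- (p :- q))) refl

  ½ : ℚ
  ½ = ratio 1 2

  0<ε⇒0<ε*½ : ∀ {ε} → 0ℚ < ε → 0ℚ < ε * ½
  0<ε⇒0<ε*½ 0<ε = 0<* 0<ε (0<ratio1 2)

  ε*½+ε*½≡ε : ∀ ε → ε * ½ + ε * ½ ≡ ε
  ε*½+ε*½≡ε ε = trans (sym (ℚ.*-distribˡ-+ ε ½ ½)) (ℚ.*-identityʳ ε)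

  archimedean : ∀ ε → 0ℚ < ε → ∃[ N ] 1ℚ ≤ ε * fromℕ N
  archimedean ε@(mkℚ (+ suc n) d _) _ = suc d , ℚ.≤-trans (fromℕ-mono-≤ {1} {suc n} (s≤s z≤n))
    (ℚ.≤-reflexive (sym (trans (cong (_* fromℕ (suc d)) (sym (ℚ.↥p/↧p≡p ε))) (ratio-*-fromℕ (suc n) (suc d)))))
  archimedean ε@(mkℚ (+ zero) d _) 0<ε = ⊥-elim (ℚ.<-irrefl (sym (ℚ.↥p≡0⇒p≡0 ε refl)) 0<ε)
  archimedean ε@(mkℚ -[1+ n ] d _) 0<ε = ⊥-elim (ℚ.<-asym 0<ε (ℚ.negative⁻¹ ε))

  archimedean-ratio : ∀ c ε → 0ℚ < ε → ∃[ P ] (2 ℕ.≤ P × fromℕ c * ratio 1 P < ε)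
  archimedean-ratio c ε 0<ε = P , s≤s (s≤s z≤n) , (begin-strict
    fromℕ c * ratio 1 P                 <⟨ *-monoˡ-<-0< (0<ratio1 P) c<εP ⟩
    (ε * fromℕ P) * ratio 1 P           ≡⟨ ℚ.*-assoc ε (fromℕ P) _ ⟩
    ε * (fromℕ P * ratio 1 P)           ≡⟨ cong (ε *_) (fromℕ-*-ratio1 P) ⟩
    ε * 1ℚ                              ≡⟨ ℚ.*-identityʳ ε ⟩
    ε                                   ∎)
    where
    open ℚ.≤-Reasoning
    N = proj₁ (archimedean ε 0<ε)
    P = 2 ℕ.+ N ℕ.* c
    c<εP : fromℕ c < ε * fromℕ P
    c<εP = begin-strict
      fromℕ c                   ≡⟨ ℚ.*-identityˡ (fromℕ c) ⟨
      1ℚ * fromℕ c              ≤⟨ *-monoˡ-≤-0≤ (0≤fromℕ c) (proj₂ (archimedean ε 0<ε)) ⟩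
      (ε * fromℕ N) * fromℕ c   ≡⟨ trans (ℚ.*-assoc ε (fromℕ N) (fromℕ c)) (cong (ε *_) (sym (fromℕ-* N c))) ⟩
      ε * fromℕ (N ℕ.* c)       <⟨ *-monoʳ-<-0< 0<ε (fromℕ-mono-< (ℕ.m<n+m (N ℕ.* c) {2} (s≤s z≤n))) ⟩
      ε * fromℕ P               ∎

  ∣p-s∣≤∣p-q∣+∣q-r∣+∣r-s∣ : ∀ p q r s → ∣ p - s ∣ ≤ ∣ p - q ∣ + (∣ q - r ∣ + ∣ r - s ∣)
  ∣p-s∣≤∣p-q∣+∣q-r∣+∣r-s∣ p q r s = begin
    ∣ p - s ∣                               ≡⟨ cong ∣_∣ (regroup p q r s) ⟩
    ∣ (p - q) + ((q - r) + (r - s)) ∣       ≤⟨ ℚ.∣p+q∣≤∣p∣+∣q∣ (p - q) _ ⟩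
    ∣ p - q ∣ + ∣ (q - r) + (r - s) ∣       ≤⟨ ℚ.+-monoʳ-≤ ∣ p - q ∣ (ℚ.∣p+q∣≤∣p∣+∣q∣ (q - r) (r - s)) ⟩
    ∣ p - q ∣ + (∣ q - r ∣ + ∣ r - s ∣)     ∎
    where
    open ℚ.≤-Reasoning
    regroup : ∀ p q r s → p - s ≡ (p - q) + ((q - r) + (r - s))
    regroup = solve 4 (λ p q r s → (p :- s) := ((p :- q) :+ ((q :- r) :+ (r :- s)))) refl

  sumℚ : List ℚ → ℚ
  sumℚ = foldr _+_ 0ℚ

  sumℚ-++ : ∀ xs ys → sumℚ (xs ++ ys) ≡ sumℚ xs + sumℚ ys
  sumℚ-++ []       ys = sym (ℚ.+-identityˡ (sumℚ ys))
  sumℚ-++ (x ∷ xs) ys = trans (cong (λ s → x + s) (sumℚ-++ xs ys)) (sym (ℚ.+-assoc x (sumℚ xs) (sumℚ ys)))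

  module _ {A : Set} where

    sumℚ-*ʳ : ∀ (f : A → ℚ) c xs → sumℚ (map (λ x → f x * c) xs) ≡ sumℚ (map f xs) * c
    sumℚ-*ʳ f c []       = sym (ℚ.*-zeroˡ c)
    sumℚ-*ʳ f c (x ∷ xs) = trans (cong (λ s → f x * c + s) (sumℚ-*ʳ f c xs)) (sym (ℚ.*-distribʳ-+ c (f x) _))

    fromℕ-sum : ∀ (f : A → ℕ) xs → fromℕ (sum (map f xs)) ≡ sumℚ (map (λ x → fromℕ (f x)) xs)
    fromℕ-sum f []       = refl
    fromℕ-sum f (x ∷ xs) = trans (fromℕ-+ (f x) _) (cong (λ s → fromℕ (f x) + s) (fromℕ-sum f xs))

    sumℚ-filter-≤ : ∀ {P : Pred A 0ℓ} (P? : Decidable P) (f : A → ℚ) xs → (∀ x → 0ℚ ≤ f x) →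
                    sumℚ (map f (filter P? xs)) ≤ sumℚ (map f xs)
    sumℚ-filter-≤ P? f []       _   = ℚ.≤-refl
    sumℚ-filter-≤ P? f (x ∷ xs) 0≤f with P? x
    ... | yes _ = ℚ.+-monoʳ-≤ (f x) (sumℚ-filter-≤ P? f xs 0≤f)
    ... | no _  = subst (_≤ f x + sumℚ (map f xs)) (ℚ.+-identityˡ _) (ℚ.+-mono-≤ (0≤f x) (sumℚ-filter-≤ P? f xs 0≤f))

    sumℚ-≥ : ∀ (f : A → ℚ) {c} xs → All (λ x → c ≤ f x) xs → fromℕ (length xs) * c ≤ sumℚ (map f xs)
    sumℚ-≥ f {c} []       []         = ℚ.≤-reflexive (ℚ.*-zeroˡ c)
    sumℚ-≥ f {c} (x ∷ xs) (c≤fx ∷ h) = begin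
      fromℕ (suc (length xs)) * c     ≡⟨ cong (_* c) (trans (fromℕ-suc (length xs)) (ℚ.+-comm (fromℕ (length xs)) 1ℚ)) ⟩
      (1ℚ + fromℕ (length xs)) * c    ≡⟨ ℚ.*-distribʳ-+ c 1ℚ (fromℕ (length xs)) ⟩
      1ℚ * c + fromℕ (length xs) * c  ≤⟨ ℚ.+-mono-≤ (ℚ.≤-reflexive (ℚ.*-identityˡ c)) (sumℚ-≥ f xs h) ⟩
      c + sumℚ (map f xs)             ≤⟨ ℚ.+-monoˡ-≤ _ c≤fx ⟩
      f x + sumℚ (map f xs)           ∎
      where open ℚ.≤-Reasoning

    0≤sumℚ : ∀ (f : A → ℚ) xs → All (λ x → 0ℚ ≤ f x) xs → 0ℚ ≤ sumℚ (map f xs)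
    0≤sumℚ f xs 0≤f = subst (_≤ sumℚ (map f xs)) (ℚ.*-zeroʳ (fromℕ (length xs))) (sumℚ-≥ f xs 0≤f)

module Convergence where

  open RationalArithmetic
  open import Data.Nat as ℕ using (ℕ; zero; suc; _⊔_)
  import Data.Nat.Properties as ℕ
  open import Data.Rational as ℚ using (ℚ; 0ℚ; 1ℚ; _+_; _*_; _-_; -_; ∣_∣; _≤_; _<_)
  import Data.Rational.Properties as ℚ
  open import Data.Rational.Solver using (module +-*-Solver)
  open +-*-Solver using (solve; _:=_; _:+_; _:*_; _:-_; :-_)
  open import Data.List using ([]; _∷_; map)
  open import Data.Empty using (⊥-elim)
  open import Relation.Nullary using (yes; no)
  open import Data.Product using (_,_; ∃-syntax; proj₁; proj₂)
  open import Function using (_∘_)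
  open import Relation.Binary.PropositionalEquality

  infix 4 _⟶_

  _⟶_ : (ℕ → ℚ) → ℚ → Set
  a ⟶ L = ∀ ε → 0ℚ < ε → ∃[ R ] (∀ r → R ℕ.≤ r → ∣ a r - L ∣ < ε)

  ⟶-const : ∀ L → (λ _ → L) ⟶ L
  ⟶-const L ε 0<ε = 0 , λ _ _ → subst (_< ε) (sym (cong ∣_∣ (ℚ.+-inverseʳ L))) 0<ε

  ⟶-cong : ∀ {a b L} → (∀ r → a r ≡ b r) → a ⟶ L → b ⟶ L
  ⟶-cong {L = L} a≗b a⟶L ε 0<ε =
    let R , close = a⟶L ε 0<ε in R , λ r R≤r → subst (λ x → ∣ x - L ∣ < ε) (a≗b r) (close r R≤r)

  ⟶-squeeze : ∀ {a b L} → (∀ r → ∣ a r - L ∣ ≤ b r) → b ⟶ 0ℚ → a ⟶ L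
  ⟶-squeeze {b = b} ∣a-L∣≤b b⟶0 ε 0<ε =
    let R , close = b⟶0 ε 0<ε
    in R , λ r R≤r → ℚ.≤-<-trans (∣a-L∣≤b r)
         (ℚ.≤-<-trans (p≤∣p∣ (b r)) (subst (λ x → ∣ x ∣ < ε) (ℚ.+-identityʳ (b r)) (close r R≤r)))

  ⟶-∘ : ∀ {a L} (k : ℕ → ℕ) → (∀ R → ∃[ R′ ] (∀ r → R′ ℕ.≤ r → R ℕ.≤ k r)) →
        a ⟶ L → (a ∘ k) ⟶ L
  ⟶-∘ k k⟶∞ a⟶L ε 0<ε =
    let R , close = a⟶L ε 0<ε
        R′ , large = k⟶∞ R
    in R′ , λ r R′≤r → close (k r) (large r R′≤r)

  ⟶-both : ∀ {a b L M} → a ⟶ L → b ⟶ M → ∀ ε → 0ℚ < ε →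
           ∃[ R ] (∀ r → R ℕ.≤ r → ∣ a r - L ∣ + ∣ b r - M ∣ < ε)
  ⟶-both a⟶L b⟶M ε 0<ε =
    let R₁ , close₁ = a⟶L (ε * ½) (0<ε⇒0<ε*½ 0<ε)
        R₂ , close₂ = b⟶M (ε * ½) (0<ε⇒0<ε*½ 0<ε)
    in R₁ ⊔ R₂ , λ r R≤r → subst (_ <_) (ε*½+ε*½≡ε ε)
         (ℚ.+-mono-< (close₁ r (ℕ.≤-trans (ℕ.m≤m⊔n R₁ R₂) R≤r))
                     (close₂ r (ℕ.≤-trans (ℕ.m≤n⊔m R₁ R₂) R≤r)))

  ⟶-- : ∀ {a b L M} → a ⟶ L → b ⟶ M → (λ r → a r - b r) ⟶ L - M
  ⟶-- {a} {b} {L} {M} a⟶L b⟶M ε 0<ε =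
    let R , close = ⟶-both {a} {b} {L} {M} a⟶L b⟶M ε 0<ε
    in R , λ r R≤r → begin-strict
      ∣ (a r - b r) - (L - M) ∣  ≡⟨ cong ∣_∣ (regroup (a r) (b r) L M) ⟩
      ∣ (a r - L) - (b r - M) ∣  ≤⟨ ℚ.∣p-q∣≤∣p∣+∣q∣ (a r - L) (b r - M) ⟩
      ∣ a r - L ∣ + ∣ b r - M ∣  <⟨ close r R≤r ⟩
      ε                          ∎
    where
    open ℚ.≤-Reasoning
    regroup : ∀ a b L M → (a - b) - (L - M) ≡ (a - L) - (b - M)
    regroup = solve 4 (λ a b L M → ((a :- b) :- (L :- M)) := ((a :- L) :- (b :- M))) refl

  ⟶-* : ∀ {a b L M} → a ⟶ L → b ⟶ M → (∀ r → ∣ b r ∣ ≤ 1ℚ) → ∣ L ∣ ≤ 1ℚ → (λ r → a r * b r) ⟶ L * M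
  ⟶-* {a} {b} {L} {M} a⟶L b⟶M ∣b∣≤1 ∣L∣≤1 ε 0<ε =
    let R , close = ⟶-both {a} {b} {L} {M} a⟶L b⟶M ε 0<ε
    in R , λ r R≤r → begin-strict
      ∣ a r * b r - L * M ∣                          ≡⟨ cong ∣_∣ (regroup (a r) (b r) L M) ⟩
      ∣ (a r - L) * b r + L * (b r - M) ∣            ≤⟨ ℚ.∣p+q∣≤∣p∣+∣q∣ ((a r - L) * b r) (L * (b r - M)) ⟩
      ∣ (a r - L) * b r ∣ + ∣ L * (b r - M) ∣        ≡⟨ cong₂ _+_ (ℚ.∣p*q∣≡∣p∣*∣q∣ (a r - L) (b r))
                                                                (ℚ.∣p*q∣≡∣p∣*∣q∣ L (b r - M)) ⟩
      ∣ a r - L ∣ * ∣ b r ∣ + ∣ L ∣ * ∣ b r - M ∣    ≤⟨ ℚ.+-mono-≤ (x*y≤x (ℚ.0≤∣p∣ (a r - L)) (∣b∣≤1 r))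
                                                                (subst (∣ L ∣ * ∣ b r - M ∣ ≤_) (ℚ.*-identityˡ _)
                                                                       (*-monoˡ-≤-0≤ (ℚ.0≤∣p∣ (b r - M)) ∣L∣≤1)) ⟩
      ∣ a r - L ∣ + ∣ b r - M ∣                      <⟨ close r R≤r ⟩
      ε                                              ∎
    where
    open ℚ.≤-Reasoning
    regroup : ∀ a b L M → a * b - L * M ≡ (a - L) * b + L * (b - M)
    regroup = solve 4 (λ a b L M → ((a :* b) :- (L :* M)) := (((a :- L) :* b) :+ (L :* (b :- M)))) refl
    x*y≤x : ∀ {x y} → 0ℚ ≤ x → y ≤ 1ℚ → x * y ≤ x
    x*y≤x {x} {y} 0≤x y≤1 = subst (x * y ≤_) (ℚ.*-identityʳ x) (*-monoʳ-≤-0≤ 0≤x y≤1)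

  ⟶-^ : ∀ {a L} m → a ⟶ L → (∀ r → 0ℚ ≤ a r) → (∀ r → a r ≤ 1ℚ) → 0ℚ ≤ L → L ≤ 1ℚ →
        (λ r → a r ^ m) ⟶ L ^ m
  ⟶-^ zero    _   _     _     _   _   = ⟶-const 1ℚ
  ⟶-^ {a} (suc m) a⟶L 0≤a a≤1 0≤L L≤1 = ⟶-* {a} {λ r → a r ^ m} a⟶L (⟶-^ m a⟶L 0≤a a≤1 0≤L L≤1)
    (λ r → ∣p∣≤1 (0≤^ m (0≤a r)) (^≤1 m (0≤a r) (a≤1 r))) (∣p∣≤1 0≤L L≤1)

  ⟶-+ : ∀ {a b L M} → a ⟶ L → b ⟶ M → (λ r → a r + b r) ⟶ L + M
  ⟶-+ {a} {b} {L} {M} a⟶L b⟶M ε 0<ε =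
    let R , close = ⟶-both {a} {b} {L} {M} a⟶L b⟶M ε 0<ε
    in R , λ r R≤r → begin-strict
      ∣ (a r + b r) - (L + M) ∣  ≡⟨ cong ∣_∣ (regroup (a r) (b r) L M) ⟩
      ∣ (a r - L) + (b r - M) ∣  ≤⟨ ℚ.∣p+q∣≤∣p∣+∣q∣ (a r - L) (b r - M) ⟩
      ∣ a r - L ∣ + ∣ b r - M ∣  <⟨ close r R≤r ⟩
      ε                          ∎
    where
    open ℚ.≤-Reasoning
    regroup : ∀ a b L M → (a + b) - (L + M) ≡ (a - L) + (b - M)
    regroup = solve 4 (λ a b L M → ((a :+ b) :- (L :+ M)) := ((a :- L) :+ (b :- M))) refl

  ⟶-sumℚ : ∀ {A : Set} (a : A → ℕ → ℚ) (L : A → ℚ) xs → (∀ x → a x ⟶ L x) →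
           (λ r → sumℚ (map (λ x → a x r) xs)) ⟶ sumℚ (map L xs)
  ⟶-sumℚ a L []       _      = ⟶-const 0ℚ
  ⟶-sumℚ a L (x ∷ xs) a⟶L = ⟶-+ {a x} {λ r → sumℚ (map (λ x → a x r) xs)} (a⟶L x) (⟶-sumℚ a L xs a⟶L)

  ⟶-≤ : ∀ {a L c} → a ⟶ L → (∀ r → a r ≤ c) → L ≤ c
  ⟶-≤ {a} {L} {c} a⟶L a≤c with L ℚ.≤? c
  ... | yes L≤c = L≤c
  ... | no  L≰c = ⊥-elim (ℚ.<-irrefl refl (ℚ.<-≤-trans c<aR (a≤c R)))
    where
    0<L-c : 0ℚ < L - c
    0<L-c = subst (_< L - c) (ℚ.+-inverseʳ c) (ℚ.+-monoˡ-< (- c) (ℚ.≰⇒> L≰c))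
    R = proj₁ (a⟶L (L - c) 0<L-c)
    L-aR<L-c : L - a R < L - c
    L-aR<L-c = ℚ.≤-<-trans (subst₂ _≤_ (negate (a R) L) (ℚ.∣-p∣≡∣p∣ (a R - L)) (p≤∣p∣ (- (a R - L))))
                           (proj₂ (a⟶L (L - c) 0<L-c) R ℕ.≤-refl)
      where
      negate : ∀ x L → - (x - L) ≡ L - x
      negate = solve 2 (λ x L → (:- (x :- L)) := (L :- x)) refl
    c<aR : c < a R
    c<aR = subst₂ _<_ (shift-left L (a R) c) (shift-right L (a R) c) (ℚ.+-monoˡ-< (a R + c - L) L-aR<L-c)
      where
      shift-left : ∀ L x c → (L - x) + (x + c - L) ≡ c
      shift-left = solve 3 (λ L x c → ((L :- x) :+ ((x :+ c) :- L)) := c) refl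
      shift-right : ∀ L x c → (L - c) + (x + c - L) ≡ x
      shift-right = solve 3 (λ L x c → ((L :- c) :+ ((x :+ c) :- L)) := x) refl

module RoughDensity where

  open import Defs using (ratio; box)
  open Counting using (count-all)
  open SymmetricBox using (width; length-box; quotient-bounds)
  open RoughPoints
  open RationalArithmetic
  open Convergence
  open import Data.Nat as ℕ using (ℕ; suc; _/_; NonZero; s≤s)
  import Data.Nat.Properties as ℕ
  import Data.Nat.DivMod as ℕ
  open import Data.Nat.Primality using (Prime; prime⇒nonZero)
  open import Data.Rational as ℚ using (ℚ; 0ℚ; 1ℚ; _+_; _*_; _-_; ∣_∣; _≤_; _<_)
  import Data.Rational.Properties as ℚ
  open import Data.Rational.Solver using (module +-*-Solver)
  open +-*-Solver using (solve; _:=_; _:+_; _:*_; _:-_; con)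

  open import Data.List using (List; []; _∷_; foldr; length)
  open import Data.List.Relation.Unary.All using (All; []; _∷_; tabulate)
  open import Data.List.Relation.Unary.AllPairs using ([]; _∷_)
  open import Data.List.Relation.Unary.Unique.Propositional using (Unique)
  open import Data.Product using (_×_; _,_; proj₁; proj₂; ∃-syntax)
  open import Relation.Binary.PropositionalEquality

  invWidth : ℕ → ℚ
  invWidth r = ratio 1 (width r)

  invWidth-*-width : ∀ r → invWidth r * fromℕ (width r) ≡ 1ℚ
  invWidth-*-width r = ratio-*-fromℕ 1 (width r)

  0≤invWidth : ∀ r → 0ℚ ≤ invWidth r
  0≤invWidth r = 0≤ratio 1 (width r)

  invWidth⟶0 : invWidth ⟶ 0ℚ
  invWidth⟶0 ε 0<ε =
    let N , 1≤εN = archimedean ε 0<ε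
    in N , λ r N≤r →
      let N<width = s≤s (ℕ.≤-trans N≤r (ℕ.m≤m+n r r))
          ∣ρ-0∣≡ρ = trans (cong ∣_∣ (ℚ.+-identityʳ (invWidth r))) (ℚ.0≤p⇒∣p∣≡p (0≤invWidth r))
      in subst (_< ε) (sym ∣ρ-0∣≡ρ) (begin-strict
        invWidth r                              ≡⟨ ℚ.*-identityˡ (invWidth r) ⟨
        1ℚ * invWidth r                         <⟨ *-monoˡ-<-0< (0<ratio1 (width r))
                                                     (ℚ.≤-<-trans 1≤εN (*-monoʳ-<-0< 0<ε (fromℕ-mono-< N<width))) ⟩
        (ε * fromℕ (width r)) * invWidth r      ≡⟨ ℚ.*-assoc ε _ _ ⟩
        ε * (fromℕ (width r) * invWidth r)      ≡⟨ cong (ε *_) (fromℕ-*-ratio1 (width r)) ⟩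
        ε * 1ℚ                                  ≡⟨ ℚ.*-identityʳ ε ⟩
        ε                                       ∎)
    where open ℚ.≤-Reasoning

  widthRatio : (q : ℕ) .{{_ : NonZero q}} → ℕ → ℚ
  widthRatio q r = fromℕ (width (r / q)) * invWidth r

  0≤widthRatio : ∀ q .{{_ : NonZero q}} r → 0ℚ ≤ widthRatio q r
  0≤widthRatio q r = 0≤* (0≤fromℕ (width (r / q))) (0≤invWidth r)

  widthRatio≤1 : ∀ q .{{_ : NonZero q}} r → widthRatio q r ≤ 1ℚ
  widthRatio≤1 q r = ℚ.≤-trans
    (*-monoˡ-≤-0≤ (0≤invWidth r) (fromℕ-mono-≤ (s≤s (ℕ.+-mono-≤ r/q≤r r/q≤r))))
    (ℚ.≤-reflexive (fromℕ-*-ratio1 (width r)))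
    where r/q≤r = ℕ.m/n≤m r q

  private
    width-bounds : ∀ q k r → q ℕ.* k ℕ.≤ r → r ℕ.< q ℕ.* suc k →
      q ℕ.* width k ℕ.< width r ℕ.+ q × width r ℕ.< q ℕ.* width k ℕ.+ q
    width-bounds q k r qk≤r r<qk+q = lower , upper
      where
      open import Data.Nat.Tactic.RingSolver using (solve-∀)
      q*width : ∀ q k → q ℕ.* suc (k ℕ.+ k) ≡ (q ℕ.* k ℕ.+ q ℕ.* k) ℕ.+ q
      q*width = solve-∀
      double : ∀ q k → q ℕ.* suc k ℕ.+ q ℕ.* suc k ≡ q ℕ.* suc (k ℕ.+ k) ℕ.+ q
      double = solve-∀
      lower = subst (ℕ._< width r ℕ.+ q) (sym (q*width q k)) (ℕ.+-monoˡ-< q (s≤s (ℕ.+-mono-≤ qk≤r qk≤r)))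
      upper = subst₂ ℕ._≤_ (cong suc (ℕ.+-suc r r)) (double q k) (ℕ.+-mono-≤ r<qk+q r<qk+q)

    widthRatio-1/q≡ : ∀ q .{{_ : NonZero q}} r →
      widthRatio q r - ratio 1 q ≡ (fromℕ (q ℕ.* width (r / q)) - fromℕ (width r)) * (invWidth r * ratio 1 q)
    widthRatio-1/q≡ q r = begin
      W * ρ - iq                           ≡⟨ insert-ones W ρ iq ⟩
      W * ρ * 1ℚ - 1ℚ * iq                 ≡⟨ cong₂ (λ x y → W * ρ * x - y * iq) (sym (fromℕ-*-ratio1 q)) (sym (invWidth-*-width r)) ⟩
      W * ρ * (Q * iq) - (ρ * E) * iq      ≡⟨ factor W ρ iq Q E ⟩
      (Q * W - E) * (ρ * iq)               ≡⟨ cong (λ x → (x - E) * (ρ * iq)) (fromℕ-* q (width (r / q))) ⟨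
      (fromℕ (q ℕ.* width (r / q)) - E) * (ρ * iq) ∎
      where
      open ≡-Reasoning
      W = fromℕ (width (r / q))
      Q = fromℕ q
      E = fromℕ (width r)
      ρ = invWidth r
      iq = ratio 1 q
      insert-ones : ∀ w ρ i → w * ρ - i ≡ w * ρ * 1ℚ - 1ℚ * i
      insert-ones = solve 3 (λ w ρ i → ((w :* ρ) :- i) := (((w :* ρ) :* con 1ℚ) :- (con 1ℚ :* i))) refl
      factor : ∀ w ρ i q e → w * ρ * (q * i) - (ρ * e) * i ≡ (q * w - e) * (ρ * i)
      factor = solve 5 (λ w ρ i q e → (((w :* ρ) :* (q :* i)) :- ((ρ :* e) :* i)) := (((q :* w) :- e) :* (ρ :* i))) refl

  -- The error is (q · width (r / q) - width r) / (q · width r), and the numerator lies in (-q, q).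
  widthRatio⟶1/q : ∀ q .{{_ : NonZero q}} → widthRatio q ⟶ ratio 1 q
  widthRatio⟶1/q q = ⟶-squeeze {widthRatio q} {invWidth} error≤invWidth invWidth⟶0
    where
    error≤invWidth : ∀ r → ∣ widthRatio q r - ratio 1 q ∣ ≤ invWidth r
    error≤invWidth r = begin
      ∣ widthRatio q r - iq ∣         ≡⟨ cong ∣_∣ (widthRatio-1/q≡ q r) ⟩
      ∣ (D - E) * (ρ * iq) ∣          ≡⟨ ℚ.∣p*q∣≡∣p∣*∣q∣ (D - E) (ρ * iq) ⟩
      ∣ D - E ∣ * ∣ ρ * iq ∣          ≡⟨ cong (∣ D - E ∣ *_) (ℚ.0≤p⇒∣p∣≡p 0≤ρiq) ⟩
      ∣ D - E ∣ * (ρ * iq)            ≤⟨ *-monoˡ-≤-0≤ 0≤ρiq ∣D-E∣≤q ⟩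
      Q * (ρ * iq)                    ≡⟨ solve 3 (λ a b c → (a :* (b :* c)) := (b :* (a :* c))) refl Q ρ iq ⟩
      ρ * (Q * iq)                    ≡⟨ cong (ρ *_) (fromℕ-*-ratio1 q) ⟩
      ρ * 1ℚ                          ≡⟨ ℚ.*-identityʳ ρ ⟩
      ρ                               ∎
      where
      open ℚ.≤-Reasoning
      k = r / q
      Q = fromℕ q
      D = fromℕ (q ℕ.* width k)
      E = fromℕ (width r)
      ρ = invWidth r
      iq = ratio 1 q
      0≤ρiq : 0ℚ ≤ ρ * iq
      0≤ρiq = 0≤* (0≤invWidth r) (0≤ratio 1 q)
      bounds = quotient-bounds r q
      lower = proj₁ (width-bounds q k r (proj₁ bounds) (proj₂ bounds))
      upper = proj₂ (width-bounds q k r (proj₁ bounds) (proj₂ bounds))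
      ∣D-E∣≤q : ∣ D - E ∣ ≤ Q
      ∣D-E∣≤q = ∣p-q∣≤c (subst (D <_) (fromℕ-+ (width r) q) (fromℕ-mono-< lower))
                        (subst (E <_) (fromℕ-+ (q ℕ.* width k) q) (fromℕ-mono-< upper))

  eulerProduct : ℕ → List ℕ → ℚ
  eulerProduct m = foldr (λ p acc → (1ℚ - ratio 1 (p ℕ.^ m)) * acc) 1ℚ

  0≤eulerProduct : ∀ m S → 0ℚ ≤ eulerProduct m S
  0≤eulerProduct m []      = 0≤1
  0≤eulerProduct m (p ∷ S) = 0≤* (p≤1⇒0≤1-p (ratio1≤1 (p ℕ.^ m))) (0≤eulerProduct m S)

  eulerProduct≤1 : ∀ m S → eulerProduct m S ≤ 1ℚ
  eulerProduct≤1 m []      = ℚ.≤-refl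
  eulerProduct≤1 m (p ∷ S) = ℚ.≤-trans (*-monoˡ-≤-0≤ (0≤eulerProduct m S) (0≤p⇒1-p≤1 (0≤ratio 1 (p ℕ.^ m))))
                                        (subst (_≤ 1ℚ) (sym (ℚ.*-identityˡ _)) (eulerProduct≤1 m S))

  roughDensity : ℕ → List ℕ → ℕ → ℚ
  roughDensity m S r = fromℕ (roughCount m S r) * invWidth r ^ m

  roughDensity-[] : ∀ m r → roughDensity m [] r ≡ 1ℚ
  roughDensity-[] m r = begin
    fromℕ (roughCount m [] r) * X             ≡⟨ cong (λ c → fromℕ c * X) (count-all (rough? []) (box m r) (tabulate (λ _ → []))) ⟩
    fromℕ (length (box m r)) * X              ≡⟨ cong (λ c → fromℕ c * X) (length-box m r) ⟩
    fromℕ (width r ℕ.^ m) * X                 ≡⟨ cong (_* X) (fromℕ-^ (width r) m) ⟩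
    fromℕ (width r) ^ m * invWidth r ^ m      ≡⟨ ^-distribʳ-* _ _ m ⟨
    (fromℕ (width r) * invWidth r) ^ m        ≡⟨ cong (_^ m) (fromℕ-*-ratio1 (width r)) ⟩
    1ℚ ^ m                                    ≡⟨ 1^n≡1 m ⟩
    1ℚ                                        ∎
    where
    open ≡-Reasoning
    X = invWidth r ^ m

  roughDensity-∷ : ∀ m q S r .{{_ : NonZero q}} → All Prime S → Prime q → All (q ≢_) S →
    roughDensity m (q ∷ S) r ≡ roughDensity m S r - roughDensity m S (r / q) * widthRatio q r ^ m
  roughDensity-∷ m q S r primes q-prime q∉S = begin
    fromℕ (roughCount m (q ∷ S) r) * X    ≡⟨ cong (_* X) count-difference ⟩
    (Cᵣ - Cₖ) * X                         ≡⟨ cong (λ z → (Cᵣ - z) * X) (ℚ.*-identityʳ Cₖ) ⟨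
    (Cᵣ - Cₖ * 1ℚ) * X                    ≡⟨ cong (λ z → (Cᵣ - Cₖ * z) * X) (sym Y*Z≡1) ⟩
    (Cᵣ - Cₖ * (Y * Z)) * X               ≡⟨ distribute Cᵣ Cₖ X Y Z ⟩
    Cᵣ * X - (Cₖ * Y) * (Z * X)           ≡⟨ cong (λ z → Cᵣ * X - (Cₖ * Y) * z) (^-distribʳ-* (fromℕ (width k)) (invWidth r) m) ⟨
    roughDensity m S r - roughDensity m S k * widthRatio q r ^ m ∎
    where
    open ≡-Reasoning
    k = r / q
    Cᵣ = fromℕ (roughCount m S r)
    Cₖ = fromℕ (roughCount m S k)
    X = invWidth r ^ m
    Y = invWidth k ^ m
    Z = fromℕ (width k) ^ m
    Y*Z≡1 : Y * Z ≡ 1ℚ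
    Y*Z≡1 = trans (sym (^-distribʳ-* (invWidth k) (fromℕ (width k)) m)) (trans (cong (_^ m) (invWidth-*-width k)) (1^n≡1 m))
    distribute : ∀ a b X Y Z → (a - b * (Y * Z)) * X ≡ a * X - (b * Y) * (Z * X)
    distribute = solve 5 (λ a b X Y Z → ((a :- (b :* (Y :* Z))) :* X) := ((a :* X) :- ((b :* Y) :* (Z :* X)))) refl
    add-sub : ∀ a b → (a + b) - b ≡ a
    add-sub = solve 2 (λ a b → ((a :+ b) :- b) := a) refl
    count-difference : fromℕ (roughCount m (q ∷ S) r) ≡ Cᵣ - Cₖ
    count-difference = begin
      fromℕ (roughCount m (q ∷ S) r)                            ≡⟨ add-sub _ Cₖ ⟨
      (fromℕ (roughCount m (q ∷ S) r) + Cₖ) - Cₖ                ≡⟨ cong (_- Cₖ) (fromℕ-+ (roughCount m (q ∷ S) r) _) ⟨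
      fromℕ (roughCount m (q ∷ S) r ℕ.+ roughCount m S k) - Cₖ  ≡⟨ cong (λ c → fromℕ c - Cₖ) (roughCount-∷ m q S r primes q-prime q∉S) ⟩
      Cᵣ - Cₖ                                                   ∎

  sieved⟶ : ∀ {a L} m q .{{_ : NonZero q}} → a ⟶ L → 0ℚ ≤ L → L ≤ 1ℚ →
    (λ r → a (r / q) * widthRatio q r ^ m) ⟶ L * ratio 1 q ^ m
  sieved⟶ {a} m q a⟶L 0≤L L≤1 =
    ⟶-* {λ r → a (r / q)} {λ r → widthRatio q r ^ m} (⟶-∘ {a} (_/ q) /q⟶∞ a⟶L)
      (⟶-^ m (widthRatio⟶1/q q) (0≤widthRatio q) (widthRatio≤1 q) (0≤ratio 1 q) (ratio1≤1 q))
      (λ r → ∣p∣≤1 (0≤^ m (0≤widthRatio q r)) (^≤1 m (0≤widthRatio q r) (widthRatio≤1 q r)))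
      (∣p∣≤1 0≤L L≤1)
    where
    /q⟶∞ : ∀ R → ∃[ R′ ] (∀ r → R′ ℕ.≤ r → R ℕ.≤ r / q)
    /q⟶∞ R = R ℕ.* q , λ r Rq≤r → subst (ℕ._≤ r / q) (ℕ.m*n/n≡m R q) (ℕ./-monoˡ-≤ q Rq≤r)

  roughDensity⟶eulerProduct : ∀ m S → All Prime S → Unique S → roughDensity m S ⟶ eulerProduct m S
  roughDensity⟶eulerProduct m []      _ _ = ⟶-cong {λ _ → 1ℚ} {L = 1ℚ} (λ r → sym (roughDensity-[] m r)) (⟶-const 1ℚ)
  roughDensity⟶eulerProduct m (q ∷ S) (q-prime ∷ primes) (q∉S ∷ distinct) =
    ⟶-cong {a = λ r → roughDensity m S r - multiples r} (λ r → sym (roughDensity-∷ m q S r primes q-prime q∉S))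
      (subst ((λ r → roughDensity m S r - multiples r) ⟶_) limit
        (⟶-- {roughDensity m S} {multiples} IH (sieved⟶ {roughDensity m S} m q IH (0≤eulerProduct m S) (eulerProduct≤1 m S))))
    where
    instance _ = prime⇒nonZero q-prime
    IH = roughDensity⟶eulerProduct m S primes distinct
    multiples : ℕ → ℚ
    multiples r = roughDensity m S (r / q) * widthRatio q r ^ m
    limit : eulerProduct m S - eulerProduct m S * ratio 1 q ^ m ≡ (1ℚ - ratio 1 (q ℕ.^ m)) * eulerProduct m S
    limit = trans (cong (λ z → eulerProduct m S - eulerProduct m S * z) (ratio1-^ q m)) (factor (eulerProduct m S) (ratio 1 (q ℕ.^ m)))
      where
      factor : ∀ a b → a - a * b ≡ (1ℚ - b) * a
      factor = solve 2 (λ a b → (a :- (a :* b)) := ((con 1ℚ :- b) :* a)) refl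

module Hyperplane where

  open import Defs
  open Counting
  open SymmetricBox
  open RoughPoints
  open Visibility
  open RationalArithmetic
  open Convergence
  open RoughDensity
  open import Data.Nat as ℕ using (ℕ; zero; suc; _+_; _≤_)
  import Data.Nat.Properties as ℕ
  open import Data.Nat.Divisibility using (_∣?_)
  open import Data.Nat.Primality using (Prime; prime?)
  open import Data.Integer using (ℤ; ∣_∣)
  open import Data.Rational as ℚ using (ℚ; 0ℚ; 1ℚ; _*_; _-_; _<_)
  import Data.Rational.Properties as ℚ
  open import Data.List using (List; [_]; _++_; _∷ʳ_; upTo; applyUpTo; filter; length)
  open import Data.Vec using (_∷_)
  import Data.List.Properties as List
  open import Data.List.Relation.Unary.All as All using (All)
  open import Data.List.Relation.Unary.Unique.Propositional using (Unique)
  import Data.List.Relation.Unary.Unique.Propositional.Properties as Unique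
  open import Data.Product using (Σ; proj₁)
  open import Function using (_∘_)
  open import Relation.Binary.PropositionalEquality hiding ([_])

  DensityConverges : ℕ → ℤ → Set
  DensityConverges n b = (ε : ℚ) → 0ℚ < ε →
    Σ ℕ (λ R → Σ ℕ (λ P → (r P′ : ℕ) → R ≤ r → P ≤ P′ →
      ℚ.∣ densityRatio n b r - partialProduct n b P′ ∣ < ε))

  visibleCount : ℕ → ℤ → ℕ → ℕ
  visibleCount m b r = count (visible? ∘ (b ∷_)) (box m r)

  visibleDensity : ℕ → ℤ → ℕ → ℚ
  visibleDensity m b r = fromℕ (visibleCount m b r) * invWidth r ^ m

  densityRatio≡visibleDensity : ∀ m b r → ∣ b ∣ ≤ r → densityRatio (suc m) b r ≡ visibleDensity m b r
  densityRatio≡visibleDensity m b r b≤r = begin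
    ratio (length (Δ₀ (suc m) b r)) (length (Δ₁ (suc m) b r))
      ≡⟨ cong₂ ratio (length-Δ₀ m b r b≤r) (length-Δ₁ m b r b≤r) ⟩
    ratio (visibleCount m b r) (width r ℕ.^ m)
      ≡⟨ ratio-unique (visibleCount m b r) (width r ℕ.^ m) {{ℕ.m^n≢0 (width r) m}} cancel ⟨
    V * invWidth r ^ m ∎
    where
    open ≡-Reasoning
    V = fromℕ (visibleCount m b r)
    cancel : V * invWidth r ^ m * fromℕ (width r ℕ.^ m) ≡ V
    cancel = begin
      V * invWidth r ^ m * fromℕ (width r ℕ.^ m)    ≡⟨ ℚ.*-assoc V _ _ ⟩
      V * (invWidth r ^ m * fromℕ (width r ℕ.^ m))  ≡⟨ cong (λ z → V * (invWidth r ^ m * z)) (fromℕ-^ (width r) m) ⟩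
      V * (invWidth r ^ m * fromℕ (width r) ^ m)    ≡⟨ cong (V *_) (^-distribʳ-* (invWidth r) (fromℕ (width r)) m) ⟨
      V * (invWidth r * fromℕ (width r)) ^ m        ≡⟨ cong (λ z → V * z ^ m) (invWidth-*-width r) ⟩
      V * 1ℚ ^ m                                    ≡⟨ cong (V *_) (1^n≡1 m) ⟩
      V * 1ℚ                                        ≡⟨ ℚ.*-identityʳ V ⟩
      V                                             ∎

  primesDividingUpTo-prime : ∀ b P → All Prime (primesDividingUpTo b P)
  primesDividingUpTo-prime b P = All.map proj₁ (primesDividingUpTo-primeDivisors b P)

  primesDividingUpTo-unique : ∀ b P → Unique (primesDividingUpTo b P)
  primesDividingUpTo-unique b P = Unique.filter⁺ (_∣? ∣ b ∣) (Unique.filter⁺ prime? (Unique.upTo⁺ (suc P)))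

  upTo-+ : ∀ a b → upTo (a + b) ≡ upTo a ++ applyUpTo (λ i → a + i) b
  upTo-+ a zero    = trans (cong upTo (ℕ.+-identityʳ a)) (sym (List.++-identityʳ (upTo a)))
  upTo-+ a (suc b) = begin
    upTo (a + suc b)                                     ≡⟨ cong upTo (ℕ.+-suc a b) ⟩
    upTo (suc (a + b))                                   ≡⟨ List.upTo-∷ʳ (a + b) ⟨
    upTo (a + b) ∷ʳ (a + b)                              ≡⟨ cong (_∷ʳ (a + b)) (upTo-+ a b) ⟩
    (upTo a ++ applyUpTo (λ i → a + i) b) ∷ʳ (a + b)     ≡⟨ List.++-assoc (upTo a) (applyUpTo (λ i → a + i) b) [ a + b ] ⟩
    upTo a ++ (applyUpTo (λ i → a + i) b ∷ʳ (a + b))     ≡⟨ cong (upTo a ++_) (List.applyUpTo-∷ʳ (λ i → a + i) b) ⟩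
    upTo a ++ applyUpTo (λ i → a + i) (suc b)            ∎
    where open ≡-Reasoning

  primesDividingBetween : ℤ → ℕ → ℕ → List ℕ
  primesDividingBetween b P j = filter (_∣? ∣ b ∣) (filter prime? (applyUpTo (λ i → suc P + i) j))

  primesDividingUpTo-+ : ∀ b P j → primesDividingUpTo b (P + j) ≡ primesDividingUpTo b P ++ primesDividingBetween b P j
  primesDividingUpTo-+ b P j = begin
    filter D? (filter prime? (upTo (suc P + j)))
      ≡⟨ cong (filter D? ∘ filter prime?) (upTo-+ (suc P) j) ⟩
    filter D? (filter prime? (upTo (suc P) ++ applyUpTo (λ i → suc P + i) j))
      ≡⟨ cong (filter D?) (List.filter-++ prime? (upTo (suc P)) _) ⟩
    filter D? (filter prime? (upTo (suc P)) ++ filter prime? (applyUpTo (λ i → suc P + i) j))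
      ≡⟨ List.filter-++ D? (filter prime? (upTo (suc P))) _ ⟩
    primesDividingUpTo b P ++ primesDividingBetween b P j ∎
    where
    open ≡-Reasoning
    D? = _∣? ∣ b ∣

module NonzeroOffset where

  open import Defs
  open Counting
  open RoughPoints
  open Visibility
  open RationalArithmetic using (fromℕ; _^_)
  open RoughDensity
  open Hyperplane
  open import Data.Nat as ℕ using (ℕ; suc; _+_; _≤_; _<_; _⊔_; s≤s)
  import Data.Nat.Properties as ℕ
  open import Data.Nat.Divisibility using (_∣?_; ∣⇒≤)
  open import Data.Nat.Primality using (prime?)
  open import Data.Integer using (∣_∣)
  open import Data.Rational as ℚ using (_*_; _-_)
  open import Data.List using ([]; _++_)
  import Data.List.Properties as List
  import Data.List.Relation.Unary.All.Properties as All
  open import Data.Product using (_,_)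
  open import Data.Vec using (_∷_)
  open import Function using (_∘_)
  open import Relation.Binary.PropositionalEquality

  primesDividingUpTo-stable : ∀ b P → ∣ b ∣ ≢ 0 → ∣ b ∣ ≤ P → primesDividingUpTo b P ≡ primesDividingUpTo b ∣ b ∣
  primesDividingUpTo-stable b P b≢0 b≤P = begin
    primesDividingUpTo b P                                   ≡⟨ cong (primesDividingUpTo b) (ℕ.m+[n∸m]≡n b≤P) ⟨
    primesDividingUpTo b (B + (P ℕ.∸ B))                     ≡⟨ primesDividingUpTo-+ b B (P ℕ.∸ B) ⟩
    primesDividingUpTo b B ++ primesDividingBetween b B (P ℕ.∸ B)
      ≡⟨ cong (primesDividingUpTo b B ++_) (List.filter-none (_∣? B) (All.filter⁺ prime? beyond-B)) ⟩
    primesDividingUpTo b B ++ []                             ≡⟨ List.++-identityʳ _ ⟩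
    primesDividingUpTo b B                                   ∎
    where
    open ≡-Reasoning
    B = ∣ b ∣
    beyond-B = All.applyUpTo⁺₂ (λ i → suc B + i) (P ℕ.∸ B)
      (λ i d∣B → ℕ.<-irrefl refl (ℕ.<-≤-trans (s≤s (ℕ.m≤m+n B i)) (∣⇒≤ {{ℕ.≢-nonZero b≢0}} d∣B)))

  visibleCount≡roughCount : ∀ m b r → ∣ b ∣ ≢ 0 → visibleCount m b r ≡ roughCount m (primesDividingUpTo b ∣ b ∣) r
  visibleCount≡roughCount m b r b≢0 = count-cong (visible? ∘ (b ∷_)) (rough? _)
    ((λ {v} → visible⇒rough b v (primesDividingUpTo-primeDivisors b ∣ b ∣)) ,
     (λ {v} → rough⇒visible b ∣ b ∣ v b≢0 ℕ.≤-refl))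
    (box m r)

  densityConverges-b≢0 : ∀ m b → ∣ b ∣ ≢ 0 → DensityConverges (suc m) b
  densityConverges-b≢0 m b b≢0 ε 0<ε =
    let R , close = roughDensity⟶eulerProduct m S (primesDividingUpTo-prime b B) (primesDividingUpTo-unique b B) ε 0<ε
    in R ⊔ B , B , λ r P′ R⊔B≤r B≤P′ →
      let density≡ = begin
            densityRatio (suc m) b r          ≡⟨ densityRatio≡visibleDensity m b r (ℕ.≤-trans (ℕ.m≤n⊔m R B) R⊔B≤r) ⟩
            visibleDensity m b r              ≡⟨ cong (λ c → fromℕ c * invWidth r ^ m) (visibleCount≡roughCount m b r b≢0) ⟩
            roughDensity m S r                ∎
          product≡ = cong (eulerProduct m) (primesDividingUpTo-stable b P′ b≢0 B≤P′)
      in subst₂ (λ x y → ℚ.∣ x - y ∣ ℚ.< ε) (sym density≡) (sym product≡) (close r (ℕ.≤-trans (ℕ.m≤m⊔n R B) R⊔B≤r))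
    where
    open ≡-Reasoning
    B = ∣ b ∣
    S = primesDividingUpTo b B

module Telescoping where

  open import Defs using (ratio)
  open RationalArithmetic
  open import Data.Nat as ℕ using (ℕ; zero; suc; _∸_; NonZero; s≤s)
  import Data.Nat.Properties as ℕ
  open import Data.Nat.ListAction using (sum)
  open import Data.Rational as ℚ using (ℚ; 0ℚ; 1ℚ; _+_; _*_; _≤_; _<_)
  import Data.Rational.Properties as ℚ
  open import Data.Rational.Solver using (module +-*-Solver)
  open +-*-Solver using (solve; _:=_; _:+_; _:*_; con)
  open import Data.List using (List; [_]; map; _++_; applyUpTo)
  import Data.List.Properties as List
  open import Function using (_∘_)
  open import Relation.Binary.PropositionalEquality hiding ([_])

  private
    telescoping-cleared : ∀ P j .{{_ : NonZero P}} (Y : ℕ → ℚ) {K} → 0ℚ ≤ K →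
      (∀ d → P ℕ.< d → d ℕ.≤ P ℕ.+ j → Y d * fromℕ (d ℕ.* (d ∸ 1)) ≤ K) →
      fromℕ P * fromℕ (P ℕ.+ j) * sumℚ (map Y (applyUpTo (λ i → suc P ℕ.+ i) j)) ≤ K * fromℕ j
    telescoping-cleared P zero    Y {K} 0≤K bound =
      ℚ.≤-reflexive (trans (ℚ.*-zeroʳ (fromℕ P * fromℕ (P ℕ.+ 0))) (sym (ℚ.*-zeroʳ K)))
    telescoping-cleared P (suc j) Y {K} 0≤K bound = *-cancelˡ-≤-0< 0<b (begin
      b * (a * fromℕ (P ℕ.+ suc j) * sumℚ (map Y (applyUpTo f (suc j))))
        ≡⟨ cong₂ (λ c s → b * (a * c * s)) (trans (cong fromℕ (ℕ.+-suc P j)) (fromℕ-suc (P ℕ.+ j))) split ⟩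
      b * (a * (b + 1ℚ) * (s + y))                     ≡⟨ expand a b s y ⟩
      (b + 1ℚ) * (a * b * s) + a * (y * ((b + 1ℚ) * b)) ≤⟨ ℚ.+-mono-≤ (*-monoʳ-≤-0≤ 0≤b+1 IH) (*-monoʳ-≤-0≤ (0≤fromℕ P) last-term) ⟩
      (b + 1ℚ) * (K * fromℕ j) + a * K                 ≡⟨ cong (λ z → (z + 1ℚ) * (K * fromℕ j) + a * K) (fromℕ-+ P j) ⟩
      ((a + fromℕ j) + 1ℚ) * (K * fromℕ j) + a * K     ≡⟨ collect a (fromℕ j) K ⟩
      (a + fromℕ j) * (K * (fromℕ j + 1ℚ))             ≡⟨ cong₂ (λ u v → u * (K * v)) (sym (fromℕ-+ P j)) (sym (fromℕ-suc j)) ⟩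
      b * (K * fromℕ (suc j))                          ∎)
      where
      open ℚ.≤-Reasoning
      f = λ i → suc P ℕ.+ i
      a = fromℕ P
      b = fromℕ (P ℕ.+ j)
      s = sumℚ (map Y (applyUpTo f j))
      y = Y (f j)
      split : sumℚ (map Y (applyUpTo f (suc j))) ≡ s + y
      split = begin-equality
        sumℚ (map Y (applyUpTo f (suc j)))          ≡⟨ cong (sumℚ ∘ map Y) (List.applyUpTo-∷ʳ f j) ⟨
        sumℚ (map Y (applyUpTo f j ++ [ f j ]))     ≡⟨ cong sumℚ (List.map-++ Y (applyUpTo f j) [ f j ]) ⟩
        sumℚ (map Y (applyUpTo f j) ++ [ y ])       ≡⟨ sumℚ-++ (map Y (applyUpTo f j)) [ y ] ⟩
        s + (y + 0ℚ)                                ≡⟨ cong (s +_) (ℚ.+-identityʳ y) ⟩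
        s + y                                       ∎
      0<b : 0ℚ < b
      0<b = fromℕ-mono-< {0} {P ℕ.+ j} (ℕ.<-≤-trans (ℕ.>-nonZero⁻¹ P) (ℕ.m≤m+n P j))
      0≤b+1 : 0ℚ ≤ b + 1ℚ
      0≤b+1 = subst (0ℚ ≤_) (fromℕ-suc (P ℕ.+ j)) (0≤fromℕ (suc (P ℕ.+ j)))
      IH = telescoping-cleared P j Y 0≤K (λ d P<d d≤P+j → bound d P<d (ℕ.≤-trans d≤P+j (ℕ.+-monoʳ-≤ P (ℕ.n≤1+n j))))
      last-term : y * ((b + 1ℚ) * b) ≤ K
      last-term = subst (λ z → y * z ≤ K) (trans (fromℕ-* (suc (P ℕ.+ j)) (P ℕ.+ j)) (cong (_* b) (fromℕ-suc (P ℕ.+ j))))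
        (bound (f j) (s≤s (ℕ.m≤m+n P j)) (ℕ.≤-reflexive (sym (ℕ.+-suc P j))))
      expand : ∀ a b s y → b * (a * (b + 1ℚ) * (s + y)) ≡ (b + 1ℚ) * (a * b * s) + a * (y * ((b + 1ℚ) * b))
      expand = solve 4 (λ a b s y → (b :* ((a :* (b :+ con 1ℚ)) :* (s :+ y)))
                                  := (((b :+ con 1ℚ) :* ((a :* b) :* s)) :+ (a :* (y :* ((b :+ con 1ℚ) :* b))))) refl
      collect : ∀ a t K → ((a + t) + 1ℚ) * (K * t) + a * K ≡ (a + t) * (K * (t + 1ℚ))
      collect = solve 3 (λ a t K → ((((a :+ t) :+ con 1ℚ) :* (K :* t)) :+ (a :* K)) := ((a :+ t) :* (K :* (t :+ con 1ℚ)))) refl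

  -- If Y d ≤ K / (d (d - 1)), the sum telescopes: Σ_{P < d ≤ P + j} Y d ≤ K (1/P - 1/(P + j)).
  telescoping : ∀ P j .{{_ : NonZero P}} (Y : ℕ → ℚ) {K} → 0ℚ ≤ K →
    (∀ d → P ℕ.< d → d ℕ.≤ P ℕ.+ j → Y d * fromℕ (d ℕ.* (d ∸ 1)) ≤ K) →
    sumℚ (map Y (applyUpTo (λ i → suc P ℕ.+ i) j)) ≤ K * ratio 1 P
  telescoping P j Y {K} 0≤K bound = begin
    s                          ≡⟨ ℚ.*-identityʳ s ⟨
    s * 1ℚ                     ≡⟨ cong (s *_) (fromℕ-*-ratio1 P) ⟨
    s * (a * ratio 1 P)        ≡⟨ ℚ.*-assoc s a _ ⟨
    (s * a) * ratio 1 P        ≤⟨ *-monoˡ-≤-0≤ (0≤ratio 1 P) (subst (_≤ K) (ℚ.*-comm a s) a*s≤K) ⟩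
    K * ratio 1 P              ∎
    where
    open ℚ.≤-Reasoning
    a = fromℕ P
    b = fromℕ (P ℕ.+ j)
    s = sumℚ (map Y (applyUpTo (λ i → suc P ℕ.+ i) j))
    a*s≤K : a * s ≤ K
    a*s≤K = *-cancelˡ-≤-0< (fromℕ-mono-< {0} {P ℕ.+ j} (ℕ.<-≤-trans (ℕ.>-nonZero⁻¹ P) (ℕ.m≤m+n P j))) (begin
      b * (a * s)   ≡⟨ solve 3 (λ a b s → (b :* (a :* s)) := ((a :* b) :* s)) refl a b s ⟩
      a * b * s     ≤⟨ telescoping-cleared P j Y 0≤K bound ⟩
      K * fromℕ j   ≤⟨ *-monoʳ-≤-0≤ 0≤K (fromℕ-mono-≤ (ℕ.m≤n+m j P)) ⟩
      K * b         ≡⟨ ℚ.*-comm K b ⟩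
      b * K         ∎)

module ZeroOffset where

  open import Defs
  open Counting
  open SymmetricBox
  open RoughPoints
  open Visibility
  open RationalArithmetic
  open Convergence
  open RoughDensity
  open Hyperplane
  open Telescoping
  open import Data.Nat as ℕ using (ℕ; zero; suc; _∸_; _/_; NonZero; z≤n; s≤s)
  import Data.Nat.Properties as ℕ
  open import Data.Nat.ListAction using (sum)
  open import Data.Nat.Divisibility using (_∣?_)
  open import Data.Nat.Primality using (prime?)
  open import Data.Nat.Tactic.RingSolver using (solve-∀)
  open import Data.Integer using (+_)
  open import Data.Rational as ℚ using (ℚ; 1ℚ; _+_; _*_; _-_; -_; ∣_∣; _≤_; _<_)
  import Data.Rational.Properties as ℚ
  open import Data.Rational.Solver using (module +-*-Solver)
  open +-*-Solver using (solve; _:=_; _:+_; _:*_; :-_; _:-_; con)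
  open import Data.List using (List; []; _∷_; map; filter; _++_; applyUpTo)
  open import Data.List.Relation.Unary.All as All using (All; []; _∷_)
  open import Data.List.Relation.Unary.Any using (any?)
  open import Data.Vec using (_∷_)
  open import Data.Product using (_,_; proj₁; proj₂)
  open import Data.Empty using (⊥-elim)
  open import Function using (_∘_)
  open import Relation.Binary.PropositionalEquality
  open import Relation.Nullary using (yes; no)
  open import Relation.Unary.Properties using (_∩?_; ∁?)

  primesUpTo : ℕ → List ℕ
  primesUpTo = primesDividingUpTo (+ 0)

  invisibleRoughCount : ℕ → ℕ → ℕ → ℕ
  invisibleRoughCount m P r = count (rough? (primesUpTo P) ∩? ∁? (visible? ∘ (+ 0 ∷_))) (box m r)

  roughCount≡visible+invisible : ∀ m P r →
    roughCount m (primesUpTo P) r ≡ visibleCount m (+ 0) r ℕ.+ invisibleRoughCount m P r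
  roughCount≡visible+invisible m P r =
    trans (count-partition (rough? (primesUpTo P)) (visible? ∘ (+ 0 ∷_)) (box m r))
          (cong (ℕ._+ invisibleRoughCount m P r)
                (count-cong (rough? (primesUpTo P) ∩? (visible? ∘ (+ 0 ∷_))) (visible? ∘ (+ 0 ∷_))
                            (proj₂ , λ {v} vis → visible⇒rough (+ 0) v (primesDividingUpTo-primeDivisors (+ 0) P) vis , vis)
                            (box m r)))

  invisibleRoughCount≤ : ∀ m P r → 2 ℕ.≤ P →
    invisibleRoughCount m P r ℕ.≤ sum (map (λ d → count (d ∣ᵛ?_) (box m r)) (largeDivisors P r))
  invisibleRoughCount≤ m P r 2≤P = ℕ.≤-trans
    (count-mono _ (λ v → any? (_∣ᵛ? v) (largeDivisors P r)) (box m r)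
      (All.map (λ v≤r (rough , invisible) → nonvisible-rough⇒largeDivisor P r _ 2≤P v≤r rough invisible) (box-bounded m r)))
    (count-any (λ d → d ∣ᵛ?_) (largeDivisors P r) (box m r))

  private
    width[r/d]*d≤2*width : ∀ r d .{{_ : NonZero d}} → d ℕ.≤ r → width (r / d) ℕ.* d ℕ.≤ 2 ℕ.* width r
    width[r/d]*d≤2*width r d d≤r = begin
      width k ℕ.* d                              ≡⟨ expand d k ⟩
      d ℕ.+ (d ℕ.* k ℕ.+ d ℕ.* k)                ≤⟨ ℕ.+-mono-≤ d≤r (ℕ.+-mono-≤ dk≤r dk≤r) ⟩
      r ℕ.+ (r ℕ.+ r)                            ≤⟨ ℕ.+-monoˡ-≤ (r ℕ.+ r) (ℕ.m≤m+n r r) ⟩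
      (r ℕ.+ r) ℕ.+ (r ℕ.+ r)                    ≤⟨ ℕ.m≤n⇒m≤1+n (ℕ.n≤1+n _) ⟩
      suc (suc ((r ℕ.+ r) ℕ.+ (r ℕ.+ r)))        ≡⟨ double r ⟨
      2 ℕ.* width r                              ∎
      where
      open ℕ.≤-Reasoning
      k = r / d
      dk≤r = proj₁ (quotient-bounds r d)
      expand : ∀ d k → suc (k ℕ.+ k) ℕ.* d ≡ d ℕ.+ (d ℕ.* k ℕ.+ d ℕ.* k)
      expand = solve-∀
      double : ∀ r → 2 ℕ.* suc (r ℕ.+ r) ≡ suc (suc ((r ℕ.+ r) ℕ.+ (r ℕ.+ r)))
      double = solve-∀

    d*[d∸1]≤d^m : ∀ d {m} → 2 ℕ.≤ m → d ℕ.* (d ∸ 1) ℕ.≤ d ℕ.^ m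
    d*[d∸1]≤d^m zero    _   = z≤n
    d*[d∸1]≤d^m (suc d) {m} 2≤m = begin
      suc d ℕ.* d            ≤⟨ ℕ.*-monoʳ-≤ (suc d) (ℕ.n≤1+n d) ⟩
      suc d ℕ.* suc d        ≡⟨ cong (suc d ℕ.*_) (ℕ.*-identityʳ (suc d)) ⟨
      suc d ℕ.^ 2            ≤⟨ ℕ.^-monoʳ-≤ (suc d) 2≤m ⟩
      suc d ℕ.^ m            ∎
      where open ℕ.≤-Reasoning

  multiplesDensity*d[d∸1]≤2^m : ∀ m r d .{{_ : NonZero d}} → 2 ℕ.≤ m → d ℕ.≤ r →
    (fromℕ (count (d ∣ᵛ?_) (box m r)) * invWidth r ^ m) * fromℕ (d ℕ.* (d ∸ 1)) ≤ fromℕ (2 ℕ.^ m)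
  multiplesDensity*d[d∸1]≤2^m m r d 2≤m d≤r = begin
    (fromℕ (count (d ∣ᵛ?_) (box m r)) * X) * fromℕ (d ℕ.* (d ∸ 1))
      ≡⟨ cong (λ c → (fromℕ c * X) * fromℕ (d ℕ.* (d ∸ 1))) (count-∣ᵛ-box m r d) ⟩
    (fromℕ (width k ℕ.^ m) * X) * fromℕ (d ℕ.* (d ∸ 1))
      ≤⟨ *-monoʳ-≤-0≤ (0≤* (0≤fromℕ (width k ℕ.^ m)) (0≤^ m (0≤invWidth r)))
                      (fromℕ-mono-≤ (d*[d∸1]≤d^m d 2≤m)) ⟩
    (fromℕ (width k ℕ.^ m) * X) * fromℕ (d ℕ.^ m)
      ≡⟨ cong₂ (λ u v → (u * X) * v) (fromℕ-^ (width k) m) (fromℕ-^ d m) ⟩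
    (fromℕ (width k) ^ m * invWidth r ^ m) * fromℕ d ^ m
      ≡⟨ cong (_* fromℕ d ^ m) (^-distribʳ-* (fromℕ (width k)) (invWidth r) m) ⟨
    (fromℕ (width k) * invWidth r) ^ m * fromℕ d ^ m
      ≡⟨ ^-distribʳ-* (fromℕ (width k) * invWidth r) (fromℕ d) m ⟨
    ((fromℕ (width k) * invWidth r) * fromℕ d) ^ m
      ≤⟨ ^-monoˡ-≤ m (0≤* (0≤* (0≤fromℕ (width k)) (0≤invWidth r)) (0≤fromℕ d)) base ⟩
    fromℕ 2 ^ m
      ≡⟨ fromℕ-^ 2 m ⟨
    fromℕ (2 ℕ.^ m) ∎
    where
    open ℚ.≤-Reasoning
    k = r / d
    X = invWidth r ^ m
    base : (fromℕ (width k) * invWidth r) * fromℕ d ≤ fromℕ 2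
    base = begin
      (fromℕ (width k) * invWidth r) * fromℕ d   ≡⟨ solve 3 (λ a b c → ((a :* b) :* c) := ((a :* c) :* b)) refl
                                                           (fromℕ (width k)) (invWidth r) (fromℕ d) ⟩
      (fromℕ (width k) * fromℕ d) * invWidth r   ≡⟨ cong (_* invWidth r) (fromℕ-* (width k) d) ⟨
      fromℕ (width k ℕ.* d) * invWidth r         ≤⟨ *-monoˡ-≤-0≤ (0≤invWidth r) (fromℕ-mono-≤ (width[r/d]*d≤2*width r d d≤r)) ⟩
      fromℕ (2 ℕ.* width r) * invWidth r         ≡⟨ cong (_* invWidth r) (fromℕ-* 2 (width r)) ⟩
      (fromℕ 2 * fromℕ (width r)) * invWidth r   ≡⟨ ℚ.*-assoc (fromℕ 2) (fromℕ (width r)) (invWidth r) ⟩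
      fromℕ 2 * (fromℕ (width r) * invWidth r)   ≡⟨ cong (fromℕ 2 *_) (fromℕ-*-ratio1 (width r)) ⟩
      fromℕ 2 * 1ℚ                               ≡⟨ ℚ.*-identityʳ (fromℕ 2) ⟩
      fromℕ 2                                    ∎

  -- A rough but invisible point has all coordinates divisible by some d ∈ (P, r]; for each d there are
  -- width (r / d) ^ m such points, and width (r / d) ^ m / width r ^ m ≤ (2 / d) ^ m ≤ 2 ^ m / (d (d - 1)).
  invisibleRoughDensity≤ : ∀ m P r → 2 ℕ.≤ m → 2 ℕ.≤ P →
    fromℕ (invisibleRoughCount m P r) * invWidth r ^ m ≤ fromℕ (2 ℕ.^ m) * ratio 1 P
  invisibleRoughDensity≤ m P r 2≤m 2≤P = begin
    fromℕ (invisibleRoughCount m P r) * X                        ≤⟨ *-monoˡ-≤-0≤ 0≤X (fromℕ-mono-≤ (invisibleRoughCount≤ m P r 2≤P)) ⟩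
    fromℕ (sum (map multiples (largeDivisors P r))) * X          ≡⟨ cong (_* X) (fromℕ-sum multiples (largeDivisors P r)) ⟩
    sumℚ (map (fromℕ ∘ multiples) (largeDivisors P r)) * X       ≡⟨ sumℚ-*ʳ (fromℕ ∘ multiples) X (largeDivisors P r) ⟨
    sumℚ (map (λ d → fromℕ (multiples d) * X) (largeDivisors P r))
      ≤⟨ telescoping P (r ∸ P) {{P≢0}} (λ d → fromℕ (multiples d) * X) (0≤fromℕ (2 ℕ.^ m)) term-bound ⟩
    fromℕ (2 ℕ.^ m) * ratio 1 P                                  ∎
    where
    open ℚ.≤-Reasoning
    X = invWidth r ^ m
    0≤X = 0≤^ m (0≤invWidth r)
    multiples = λ d → count (d ∣ᵛ?_) (box m r)
    P≢0 = ℕ.>-nonZero (ℕ.<-≤-trans (s≤s z≤n) 2≤P)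
    term-bound : ∀ d → P ℕ.< d → d ℕ.≤ P ℕ.+ (r ∸ P) → (fromℕ (multiples d) * X) * fromℕ (d ℕ.* (d ∸ 1)) ≤ fromℕ (2 ℕ.^ m)
    term-bound d P<d d≤P+[r∸P] with P ℕ.≤? r
    ... | yes P≤r = multiplesDensity*d[d∸1]≤2^m m r d {{ℕ.>-nonZero (ℕ.<-≤-trans (s≤s z≤n) P<d)}} 2≤m
                      (subst (d ℕ.≤_) (ℕ.m+[n∸m]≡n P≤r) d≤P+[r∸P])
    ... | no  P≰r = ⊥-elim (ℕ.<-irrefl refl (ℕ.<-≤-trans P<d (subst (d ℕ.≤_) P+[r∸P]≡P d≤P+[r∸P])))
      where P+[r∸P]≡P = trans (cong (P ℕ.+_) (ℕ.m≤n⇒m∸n≡0 (ℕ.<⇒≤ (ℕ.≰⇒> P≰r)))) (ℕ.+-identityʳ P)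

  ∣visibleDensity-roughDensity∣≤ : ∀ m P r → 2 ℕ.≤ m → 2 ℕ.≤ P →
    ∣ visibleDensity m (+ 0) r - roughDensity m (primesUpTo P) r ∣ ≤ fromℕ (2 ℕ.^ m) * ratio 1 P
  ∣visibleDensity-roughDensity∣≤ m P r 2≤m 2≤P = begin
    ∣ V * X - fromℕ (roughCount m (primesUpTo P) r) * X ∣     ≡⟨ cong (λ c → ∣ V * X - fromℕ c * X ∣) (roughCount≡visible+invisible m P r) ⟩
    ∣ V * X - fromℕ (visibleCount m (+ 0) r ℕ.+ I) * X ∣      ≡⟨ cong (λ c → ∣ V * X - c * X ∣) (fromℕ-+ (visibleCount m (+ 0) r) I) ⟩
    ∣ V * X - (V + fromℕ I) * X ∣                             ≡⟨ cong ∣_∣ (cancel V (fromℕ I) X) ⟩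
    ∣ - (fromℕ I * X) ∣                                       ≡⟨ ℚ.∣-p∣≡∣p∣ (fromℕ I * X) ⟩
    ∣ fromℕ I * X ∣                                           ≡⟨ ℚ.0≤p⇒∣p∣≡p (0≤* (0≤fromℕ I) (0≤^ m (0≤invWidth r))) ⟩
    fromℕ I * X                                               ≤⟨ invisibleRoughDensity≤ m P r 2≤m 2≤P ⟩
    fromℕ (2 ℕ.^ m) * ratio 1 P                               ∎
    where
    open ℚ.≤-Reasoning
    X = invWidth r ^ m
    V = fromℕ (visibleCount m (+ 0) r)
    I = invisibleRoughCount m P r
    cancel : ∀ v i x → v * x - (v + i) * x ≡ - (i * x)
    cancel = solve 3 (λ v i x → ((v :* x) :- ((v :+ i) :* x)) := (:- (i :* x))) refl

  eulerProduct-++ : ∀ m xs ys → eulerProduct m (xs ++ ys) ≡ eulerProduct m xs * eulerProduct m ys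
  eulerProduct-++ m []       ys = sym (ℚ.*-identityˡ (eulerProduct m ys))
  eulerProduct-++ m (p ∷ xs) ys = trans (cong ((1ℚ - ratio 1 (p ℕ.^ m)) *_) (eulerProduct-++ m xs ys))
                                        (sym (ℚ.*-assoc (1ℚ - ratio 1 (p ℕ.^ m)) (eulerProduct m xs) (eulerProduct m ys)))

  1-eulerProduct≤sum : ∀ m xs → 1ℚ - eulerProduct m xs ≤ sumℚ (map (λ p → ratio 1 (p ℕ.^ m)) xs)
  1-eulerProduct≤sum m []       = ℚ.≤-reflexive (ℚ.+-inverseʳ 1ℚ)
  1-eulerProduct≤sum m (p ∷ xs) = begin
    1ℚ - (1ℚ - x) * F          ≡⟨ regroup x F ⟩
    (1ℚ - F) + x * F           ≤⟨ ℚ.+-mono-≤ (1-eulerProduct≤sum m xs) x*F≤x ⟩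
    sumℚ (map (λ p → ratio 1 (p ℕ.^ m)) xs) + x ≡⟨ ℚ.+-comm _ x ⟩
    x + sumℚ (map (λ p → ratio 1 (p ℕ.^ m)) xs) ∎
    where
    open ℚ.≤-Reasoning
    x = ratio 1 (p ℕ.^ m)
    F = eulerProduct m xs
    x*F≤x = subst (x * F ≤_) (ℚ.*-identityʳ x) (*-monoʳ-≤-0≤ (0≤ratio 1 (p ℕ.^ m)) (eulerProduct≤1 m xs))
    regroup : ∀ x F → 1ℚ - (1ℚ - x) * F ≡ (1ℚ - F) + x * F
    regroup = solve 2 (λ x F → (con 1ℚ :- ((con 1ℚ :- x) :* F)) := ((con 1ℚ :- F) :+ (x :* F))) refl

  -- The primes in (P, P′] multiply the product by F′ / F, and 1 - F′ / F ≤ Σ_{P < p} p ^ -m ≤ 1 / P.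
  ∣eulerProduct-eulerProduct∣≤ : ∀ m P P′ .{{_ : NonZero P}} → 2 ℕ.≤ m → P ℕ.≤ P′ →
    ∣ eulerProduct m (primesUpTo P) - eulerProduct m (primesUpTo P′) ∣ ≤ ratio 1 P
  ∣eulerProduct-eulerProduct∣≤ m P P′ 2≤m P≤P′ = subst (λ F′ → ∣ F - F′ ∣ ≤ ratio 1 P) F′≡F*Fₜ (begin
    ∣ F - F * Fₜ ∣                          ≡⟨ cong ∣_∣ (factor F Fₜ) ⟩
    ∣ F * (1ℚ - Fₜ) ∣                       ≡⟨ ℚ.0≤p⇒∣p∣≡p (0≤* (0≤eulerProduct m (primesUpTo P)) 0≤1-Fₜ) ⟩
    F * (1ℚ - Fₜ)                           ≤⟨ *-monoˡ-≤-0≤ 0≤1-Fₜ (eulerProduct≤1 m (primesUpTo P)) ⟩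
    1ℚ * (1ℚ - Fₜ)                          ≡⟨ ℚ.*-identityˡ _ ⟩
    1ℚ - Fₜ                                 ≤⟨ 1-eulerProduct≤sum m T ⟩
    sumℚ (map g T)                          ≤⟨ sumℚ-filter-≤ (_∣? 0) g (filter prime? ds) 0≤g ⟩
    sumℚ (map g (filter prime? ds))         ≤⟨ sumℚ-filter-≤ prime? g ds 0≤g ⟩
    sumℚ (map g ds)                         ≤⟨ telescoping P j g 0≤1 term-bound ⟩
    1ℚ * ratio 1 P                          ≡⟨ ℚ.*-identityˡ _ ⟩
    ratio 1 P                               ∎)
    where
    open ℚ.≤-Reasoning
    j = P′ ∸ P
    T = primesDividingBetween (+ 0) P j
    ds = applyUpTo (λ i → suc P ℕ.+ i) j
    F = eulerProduct m (primesUpTo P)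
    Fₜ = eulerProduct m T
    g = λ d → ratio 1 (d ℕ.^ m)
    0≤g = λ d → 0≤ratio 1 (d ℕ.^ m)
    0≤1-Fₜ = p≤1⇒0≤1-p (eulerProduct≤1 m T)
    F′≡F*Fₜ : F * Fₜ ≡ eulerProduct m (primesUpTo P′)
    F′≡F*Fₜ = trans (sym (eulerProduct-++ m (primesUpTo P) T))
                    (cong (eulerProduct m) (trans (sym (primesDividingUpTo-+ (+ 0) P j)) (cong primesUpTo (ℕ.m+[n∸m]≡n P≤P′))))
    factor : ∀ a b → a - a * b ≡ a * (1ℚ - b)
    factor = solve 2 (λ a b → (a :- (a :* b)) := (a :* (con 1ℚ :- b))) refl
    term-bound : ∀ d → P ℕ.< d → d ℕ.≤ P ℕ.+ j → g d * fromℕ (d ℕ.* (d ∸ 1)) ≤ 1ℚ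
    term-bound d P<d _ = ℚ.≤-trans (*-monoʳ-≤-0≤ (0≤g d) (fromℕ-mono-≤ (d*[d∸1]≤d^m d 2≤m)))
                                   (ℚ.≤-reflexive (ratio-*-fromℕ 1 (d ℕ.^ m) {{ℕ.m^n≢0 d m {{d≢0}}}}))
      where d≢0 = ℕ.>-nonZero (ℕ.<-≤-trans (s≤s z≤n) P<d)

  densityConverges-b≡0-n≥3 : ∀ m → 2 ℕ.≤ m → DensityConverges (suc m) (+ 0)
  densityConverges-b≡0-n≥3 m 2≤m ε 0<ε =
    let P , 2≤P , c/P<ε/2 = archimedean-ratio (2 ℕ.^ m ℕ.+ 1) (ε * ½) (0<ε⇒0<ε*½ 0<ε)
        instance _ = ℕ.>-nonZero (ℕ.<-≤-trans (s≤s z≤n) 2≤P)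
        R , close = roughDensity⟶eulerProduct m (primesUpTo P)
                      (primesDividingUpTo-prime (+ 0) P) (primesDividingUpTo-unique (+ 0) P) (ε * ½) (0<ε⇒0<ε*½ 0<ε)
    in R , P , λ r P′ R≤r P≤P′ →
      let V = visibleDensity m (+ 0) r
          A = roughDensity m (primesUpTo P) r
          F = eulerProduct m (primesUpTo P)
          F′ = eulerProduct m (primesUpTo P′)
          K = fromℕ (2 ℕ.^ m)
      in subst (λ x → ∣ x - F′ ∣ < ε) (sym (densityRatio≡visibleDensity m (+ 0) r z≤n)) (begin-strict
        ∣ V - F′ ∣                                  ≤⟨ ∣p-s∣≤∣p-q∣+∣q-r∣+∣r-s∣ V A F F′ ⟩
        ∣ V - A ∣ + (∣ A - F ∣ + ∣ F - F′ ∣)        <⟨ ℚ.+-mono-≤-< (∣visibleDensity-roughDensity∣≤ m P r 2≤m 2≤P)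
                                                          (ℚ.+-mono-<-≤ (close r R≤r) (∣eulerProduct-eulerProduct∣≤ m P P′ 2≤m P≤P′)) ⟩
        K * ratio 1 P + (ε * ½ + ratio 1 P)         ≡⟨ collect K (ratio 1 P) (ε * ½) ⟩
        (K + 1ℚ) * ratio 1 P + ε * ½                ≡⟨ cong (λ z → z * ratio 1 P + ε * ½) (fromℕ-+ (2 ℕ.^ m) 1) ⟨
        fromℕ (2 ℕ.^ m ℕ.+ 1) * ratio 1 P + ε * ½   <⟨ ℚ.+-monoˡ-< (ε * ½) c/P<ε/2 ⟩
        ε * ½ + ε * ½                               ≡⟨ ε*½+ε*½≡ε ε ⟩
        ε                                           ∎)
    where
    open ℚ.≤-Reasoning
    collect : ∀ K p e → K * p + (e + p) ≡ (K + 1ℚ) * p + e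
    collect = solve 3 (λ K p e → ((K :* p) :+ (e :+ p)) := (((K :+ con 1ℚ) :* p) :+ e)) refl

module ZeroOffsetLine where

  open import Defs
  open Counting
  open SymmetricBox
  open RoughPoints
  open Visibility
  open RationalArithmetic
  open Convergence
  open RoughDensity
  open Hyperplane
  open ZeroOffset using (primesUpTo)
  open import Data.Nat as ℕ using (ℕ; zero; suc; _/_; NonZero; z≤n; s≤s)
  import Data.Nat.Properties as ℕ
  import Data.Nat.DivMod as ℕ
  open import Data.Nat.Divisibility using (_∣_; _∣?_; _∣0; ∣-trans; ∣-antisym; ∣⇒≤; 0∣⇒≡0)
  open import Data.Nat.Coprimality using (Coprime; coprime-divisor)
  open import Data.Nat.GCD using (gcd-identityˡ; gcd-identityʳ)
  open import Data.Integer as ℤ using (ℤ; +_)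
  open import Data.Rational as ℚ using (ℚ; 1ℚ; _+_; _*_; _-_; ∣_∣; _≤_; _<_)
  import Data.Rational.Properties as ℚ
  open import Data.Rational.Solver using (module +-*-Solver)
  open +-*-Solver using (solve; _:=_; _:+_; _:*_; _:-_; con)
  open import Data.List using (List; []; _∷_; [_]; map; length; filter; _∷ʳ_; upTo; applyUpTo)
  open import Data.Nat.ListAction using (sum)
  import Data.List.Relation.Unary.AllPairs.Properties as AllPairs
  open import Data.List.Relation.Unary.Any using (any?)
  import Data.List.Properties as List
  open import Data.List.Relation.Unary.All as All using (All; []; _∷_)
  import Data.List.Relation.Unary.All.Properties as Allₚ
  open import Data.Vec using ([]; _∷_)
  open import Data.Vec.Relation.Unary.All using ([]; _∷_)
  open import Data.Product using (_×_; _,_; proj₁; proj₂)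
  open import Data.Empty using (⊥; ⊥-elim)
  open import Function using (_∘_; id)
  open import Relation.Binary.PropositionalEquality hiding ([_])
  open import Relation.Nullary using (¬_; yes; no)
  open import Relation.Nullary.Decidable using (_×-dec_; ¬?)
  open import Relation.Unary using (Decidable)

  box-1 : ∀ r → box 1 r ≡ map (_∷ []) (interval r)
  box-1 r = trans (box-suc 0 r)
    (trans (sym (List.concatMap-map [_] (_∷ []) (interval r))) (List.concatMap-pure (map (_∷ []) (interval r))))

  count-∣∣≡1-interval≤2 : ∀ r → count (λ x → ℤ.∣ x ∣ ℕ.≟ 1) (interval r) ℕ.≤ 2
  count-∣∣≡1-interval≤2 zero          = z≤n
  count-∣∣≡1-interval≤2 (suc zero)    = s≤s (s≤s z≤n)
  count-∣∣≡1-interval≤2 (suc (suc r)) = begin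
    count unit? (interval (suc r) ∷ʳ + suc (suc r))                   ≡⟨ count-++ unit? (interval (suc r)) _ ⟩
    count unit? (interval (suc r)) ℕ.+ count unit? [ + suc (suc r) ]  ≡⟨ ℕ.+-identityʳ _ ⟩
    count unit? (interval (suc r))                                     ≤⟨ count-∣∣≡1-interval≤2 (suc r) ⟩
    2                                                                  ∎
    where
    open ℕ.≤-Reasoning
    unit? = λ (x : ℤ) → ℤ.∣ x ∣ ℕ.≟ 1

  visibleCount-line≤2 : ∀ r → visibleCount 1 (+ 0) r ℕ.≤ 2
  visibleCount-line≤2 r = begin
    count (visible? ∘ (+ 0 ∷_)) (box 1 r)                        ≡⟨ cong (count (visible? ∘ (+ 0 ∷_))) (box-1 r) ⟩
    count (visible? ∘ (+ 0 ∷_)) (map (_∷ []) (interval r))       ≡⟨ count-map (visible? ∘ (+ 0 ∷_)) (_∷ []) (interval r) ⟩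
    count (λ x → visible? (+ 0 ∷ x ∷ [])) (interval r)           ≤⟨ count-mono _ (λ x → ℤ.∣ x ∣ ℕ.≟ 1) (interval r)
                                                                                (All.tabulate (λ {x} _ → visible⇒unit {x})) ⟩
    count (λ x → ℤ.∣ x ∣ ℕ.≟ 1) (interval r)                     ≤⟨ count-∣∣≡1-interval≤2 r ⟩
    2                                                            ∎
    where
    open ℕ.≤-Reasoning
    visible⇒unit : ∀ {x} → Visible (+ 0 ∷ x ∷ []) → ℤ.∣ x ∣ ≡ 1
    visible⇒unit {x} = trans (sym (trans (gcd-identityˡ _) (gcd-identityʳ ℤ.∣ x ∣)))

  Roughℕ : List ℕ → ℕ → Set
  Roughℕ S n = All (λ p → ¬ p ∣ n) S

  roughℕ? : ∀ S → Decidable (Roughℕ S)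
  roughℕ? S n = All.all? (λ p → ¬? (p ∣? n)) S

  roughCount-1 : ∀ S r → roughCount 1 S r ≡ count (roughℕ? S ∘ ℤ.∣_∣) (interval r)
  roughCount-1 S r = begin
    count (rough? S) (box 1 r)                         ≡⟨ cong (count (rough? S)) (box-1 r) ⟩
    count (rough? S) (map (_∷ []) (interval r))        ≡⟨ count-map (rough? S) (_∷ []) (interval r) ⟩
    count (rough? S ∘ (_∷ [])) (interval r)            ≡⟨ count-cong (rough? S ∘ (_∷ [])) (roughℕ? S ∘ ℤ.∣_∣)
                                                                      (All.map (_∘ (_∷ [])) , All.map (λ p∤x → p∤x ∘ λ { (p∣x ∷ []) → p∣x }))
                                                                      (interval r) ⟩
    count (roughℕ? S ∘ ℤ.∣_∣) (interval r)             ∎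
    where open ≡-Reasoning

  Sieved : List ℕ → (k : ℕ) .{{_ : NonZero k}} → ℤ → Set
  Sieved S k x = Roughℕ S (ℤ.∣ x ∣ / k) × k ∣ ℤ.∣ x ∣

  sieved? : ∀ S k .{{_ : NonZero k}} → Decidable (Sieved S k)
  sieved? S k x = roughℕ? S (ℤ.∣ x ∣ / k) ×-dec (k ∣? ℤ.∣ x ∣)

  count-sieved : ∀ S k .{{_ : NonZero k}} r → count (sieved? S k) (interval r) ≡ roughCount 1 S (r / k)
  count-sieved S k r = begin
    count (sieved? S k) (interval r)
      ≡⟨ count-filter (roughℕ? S ∘ (_/ k) ∘ ℤ.∣_∣) (λ x → k ∣? ℤ.∣ x ∣) (interval r) ⟨
    count (roughℕ? S ∘ (_/ k) ∘ ℤ.∣_∣) (filter (λ x → k ∣? ℤ.∣ x ∣) (interval r))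
      ≡⟨ cong (count (roughℕ? S ∘ (_/ k) ∘ ℤ.∣_∣)) (filter-∣-interval k r (r / k) (proj₁ bounds) (proj₂ bounds)) ⟩
    count (roughℕ? S ∘ (_/ k) ∘ ℤ.∣_∣) (map (scaleℤ k) (interval (r / k)))
      ≡⟨ count-map (roughℕ? S ∘ (_/ k) ∘ ℤ.∣_∣) (scaleℤ k) (interval (r / k)) ⟩
    count (roughℕ? S ∘ (_/ k) ∘ ℤ.∣_∣ ∘ scaleℤ k) (interval (r / k))
      ≡⟨ count-cong (roughℕ? S ∘ (_/ k) ∘ ℤ.∣_∣ ∘ scaleℤ k) (roughℕ? S ∘ ℤ.∣_∣)
                    ((λ {x} → subst (Roughℕ S) (unscale x)) , (λ {x} → subst (Roughℕ S) (sym (unscale x)))) (interval (r / k)) ⟩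
    count (roughℕ? S ∘ ℤ.∣_∣) (interval (r / k))
      ≡⟨ roughCount-1 S (r / k) ⟨
    roughCount 1 S (r / k) ∎
    where
    open ≡-Reasoning
    bounds = quotient-bounds r k
    unscale : ∀ x → ℤ.∣ scaleℤ k x ∣ / k ≡ ℤ.∣ x ∣
    unscale x = trans (cong (_/ k) (trans (∣scaleℤ∣ k x) (ℕ.*-comm k _))) (ℕ.m*n/n≡m _ k)

  -- Every prime factor of k is at most P, so none divides the P-rough cofactor ∣ x ∣ / k′.
  sieved-∣ : ∀ P k k′ .{{_ : NonZero k}} .{{_ : NonZero k′}} {x} → k ℕ.≤ P →
    Sieved (primesUpTo P) k x → Sieved (primesUpTo P) k′ x → k ∣ k′
  sieved-∣ P k k′ {x} k≤P (_ , k∣x) (rough′ , k′∣x) =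
    coprime-divisor k⊥x/k′ (subst (k ∣_) (sym (ℕ.m/n*n≡m k′∣x)) k∣x)
    where
    k⊥x/k′ : Coprime k (ℤ.∣ x ∣ / k′)
    k⊥x/k′ {d} (d∣k , d∣x/k′) with d ℕ.≟ 1
    ... | yes d≡1 = d≡1
    ... | no  d≢1 =
      let d≢0 = λ d≡0 → ℕ.≢-nonZero⁻¹ k (0∣⇒≡0 (subst (_∣ k) d≡0 d∣k))
          p , p-prime , p∣d = prime-divisor d≢0 d≢1
          p≤P = ℕ.≤-trans (∣⇒≤ (∣-trans p∣d d∣k)) k≤P
      in ⊥-elim (All.lookup rough′ (∈-primesDividingUpTo⁺ (+ 0) P p-prime (p ∣0) p≤P) (∣-trans p∣d d∣x/k′))

  sieved-disjoint : ∀ P k k′ .{{_ : NonZero k}} .{{_ : NonZero k′}} {x} → k ℕ.≤ P → k′ ℕ.≤ P →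
    Sieved (primesUpTo P) k x → Sieved (primesUpTo P) k′ x → k ≡ k′
  sieved-disjoint P k k′ {x} k≤P k′≤P sieved sieved′ =
    ∣-antisym (sieved-∣ P k k′ {x} k≤P sieved sieved′) (sieved-∣ P k′ k {x} k′≤P sieved′ sieved)

  sum-roughCount≤width : ∀ P r → sum (map (λ i → roughCount 1 (primesUpTo P) (r / suc i)) (upTo P)) ℕ.≤ width r
  sum-roughCount≤width P r = begin
    sum (map (λ i → roughCount 1 S (r / suc i)) (upTo P))
      ≡⟨ cong sum (List.map-cong (λ i → count-sieved S (suc i) r) (upTo P)) ⟨
    sum (map (λ i → count (sieved? S (suc i)) (interval r)) (upTo P))
      ≡⟨ count-any-disjoint (λ i → sieved? S (suc i)) (upTo P) (interval r) (AllPairs.applyUpTo⁺₁ id P disjoint) ⟩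
    count (λ x → any? (λ i → sieved? S (suc i) x) (upTo P)) (interval r)
      ≤⟨ List.length-filter _ (interval r) ⟩
    length (interval r)
      ≡⟨ length-interval r ⟩
    width r ∎
    where
    open ℕ.≤-Reasoning
    S = primesUpTo P
    disjoint : ∀ {i j} → i ℕ.< j → j ℕ.< P → ∀ {x} → Sieved S (suc i) x → Sieved S (suc j) x → ⊥
    disjoint {i} {j} i<j j<P {x} sᵢ sⱼ =
      ℕ.<⇒≢ i<j (ℕ.suc-injective (sieved-disjoint P (suc i) (suc j) {x} (ℕ.<-trans i<j j<P) j<P sᵢ sⱼ))

  harmonic : ℕ → ℚ
  harmonic P = sumℚ (map (λ i → ratio 1 (suc i)) (upTo P))

  sievedDensity : ℕ → ℕ → ℚ
  sievedDensity P r = sumℚ (map (λ i → roughDensity 1 (primesUpTo P) (r / suc i) * widthRatio (suc i) r ^ 1) (upTo P))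

  sievedDensity≤1 : ∀ P r → sievedDensity P r ≤ 1ℚ
  sievedDensity≤1 P r = begin
    sievedDensity P r
      ≡⟨ cong sumℚ (List.map-cong (λ i → term≡ (suc i)) (upTo P)) ⟩
    sumℚ (map (λ i → fromℕ (C i) * invWidth r) (upTo P))
      ≡⟨ sumℚ-*ʳ (fromℕ ∘ C) (invWidth r) (upTo P) ⟩
    sumℚ (map (fromℕ ∘ C) (upTo P)) * invWidth r
      ≡⟨ cong (_* invWidth r) (fromℕ-sum C (upTo P)) ⟨
    fromℕ (sum (map C (upTo P))) * invWidth r
      ≤⟨ *-monoˡ-≤-0≤ (0≤invWidth r) (fromℕ-mono-≤ (sum-roughCount≤width P r)) ⟩
    fromℕ (width r) * invWidth r
      ≡⟨ fromℕ-*-ratio1 (width r) ⟩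
    1ℚ ∎
    where
    open ℚ.≤-Reasoning
    S = primesUpTo P
    C = λ i → roughCount 1 S (r / suc i)
    term≡ : ∀ k .{{_ : NonZero k}} → roughDensity 1 S (r / k) * widthRatio k r ^ 1 ≡ fromℕ (roughCount 1 S (r / k)) * invWidth r
    term≡ k = begin-equality
      c * (ρₖ * 1ℚ) * ((w * ρ) * 1ℚ)  ≡⟨ regroup c ρₖ w ρ ⟩
      c * ρ * (ρₖ * w)                ≡⟨ cong (c * ρ *_) (invWidth-*-width (r / k)) ⟩
      c * ρ * 1ℚ                      ≡⟨ ℚ.*-identityʳ (c * ρ) ⟩
      c * ρ                           ∎
      where
      c = fromℕ (roughCount 1 S (r / k))
      ρₖ = invWidth (r / k)
      w = fromℕ (width (r / k))
      ρ = invWidth r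
      regroup : ∀ c ρₖ w ρ → c * (ρₖ * 1ℚ) * ((w * ρ) * 1ℚ) ≡ c * ρ * (ρₖ * w)
      regroup = solve 4 (λ c ρₖ w ρ → ((c :* (ρₖ :* con 1ℚ)) :* ((w :* ρ) :* con 1ℚ)) := ((c :* ρ) :* (ρₖ :* w))) refl

  -- For k ≤ P the sets Sieved (primesUpTo P) k are pairwise disjoint, and the k-th has density F / k
  -- where F is the Euler product; so these densities add up to at most 1.
  harmonic*eulerProduct≤1 : ∀ P → harmonic P * eulerProduct 1 (primesUpTo P) ≤ 1ℚ
  harmonic*eulerProduct≤1 P = subst (_≤ 1ℚ) limit≡ (⟶-≤ {sievedDensity P} sievedDensity⟶ (sievedDensity≤1 P))
    where
    S = primesUpTo P
    F = eulerProduct 1 S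
    sievedDensity⟶ : sievedDensity P ⟶ sumℚ (map (λ i → F * ratio 1 (suc i) ^ 1) (upTo P))
    sievedDensity⟶ = ⟶-sumℚ (λ i r → roughDensity 1 S (r / suc i) * widthRatio (suc i) r ^ 1)
                              (λ i → F * ratio 1 (suc i) ^ 1) (upTo P)
      (λ i → sieved⟶ {roughDensity 1 S} 1 (suc i)
               (roughDensity⟶eulerProduct 1 S (primesDividingUpTo-prime (+ 0) P) (primesDividingUpTo-unique (+ 0) P))
               (0≤eulerProduct 1 S) (eulerProduct≤1 1 S))
    limit≡ : sumℚ (map (λ i → F * ratio 1 (suc i) ^ 1) (upTo P)) ≡ harmonic P * F
    limit≡ = trans (cong sumℚ (List.map-cong (λ i → trans (cong (F *_) (ℚ.*-identityʳ (h i))) (ℚ.*-comm F (h i))) (upTo P)))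
                   (sumℚ-*ʳ h F (upTo P))
      where h = λ i → ratio 1 (suc i)

  private
    harmonic-+ : ∀ a b → harmonic (a ℕ.+ b) ≡ harmonic a + sumℚ (map (λ i → ratio 1 (suc i)) (applyUpTo (λ i → a ℕ.+ i) b))
    harmonic-+ a b = trans (cong (sumℚ ∘ map h) (upTo-+ a b))
                           (trans (cong sumℚ (List.map-++ h (upTo a) _)) (sumℚ-++ (map h (upTo a)) _))
      where h = λ i → ratio 1 (suc i)

  harmonic-mono : ∀ {a b} → a ℕ.≤ b → harmonic a ≤ harmonic b
  harmonic-mono {a} {b} a≤b = subst (λ c → harmonic a ≤ harmonic c) (ℕ.m+[n∸m]≡n a≤b)
    (subst (harmonic a ≤_) (sym (harmonic-+ a (b ℕ.∸ a)))
      (subst (_≤ harmonic a + sumℚ (map h tail)) (ℚ.+-identityʳ (harmonic a))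
        (ℚ.+-monoʳ-≤ (harmonic a) (0≤sumℚ h tail (All.tabulate (λ {i} _ → 0≤ratio 1 (suc i)))))))
    where
    h = λ i → ratio 1 (suc i)
    tail = applyUpTo (λ i → a ℕ.+ i) (b ℕ.∸ a)

  ½≤harmonic-block : ∀ M .{{_ : NonZero M}} → ½ ≤ sumℚ (map (λ i → ratio 1 (suc i)) (applyUpTo (λ i → M ℕ.+ i) M))
  ½≤harmonic-block M = begin
    ½                                              ≡⟨ M*ratio≡½ ⟨
    fromℕ M * ratio 1 (M ℕ.+ M)                    ≡⟨ cong (λ n → fromℕ n * ratio 1 (M ℕ.+ M)) (List.length-applyUpTo (λ i → M ℕ.+ i) M) ⟨
    fromℕ (length block) * ratio 1 (M ℕ.+ M)       ≤⟨ sumℚ-≥ (λ i → ratio 1 (suc i)) block (Allₚ.applyUpTo⁺₁ (λ i → M ℕ.+ i) M term≥) ⟩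
    sumℚ (map (λ i → ratio 1 (suc i)) block)       ∎
    where
    open ℚ.≤-Reasoning
    block = applyUpTo (λ i → M ℕ.+ i) M
    term≥ : ∀ {i} → i ℕ.< M → ratio 1 (M ℕ.+ M) ≤ ratio 1 (suc (M ℕ.+ i))
    term≥ {i} i<M = ratio1-antitone {suc (M ℕ.+ i)} (subst (ℕ._≤ M ℕ.+ M) (ℕ.+-suc M i) (ℕ.+-monoʳ-≤ M i<M))
    instance _ = ℕ.>-nonZero (ℕ.<-≤-trans (ℕ.>-nonZero⁻¹ M) (ℕ.m≤m+n M M))
    M*ratio≡½ : fromℕ M * ratio 1 (M ℕ.+ M) ≡ ½
    M*ratio≡½ = ratio-unique 1 2 (begin-equality
      fromℕ M * ratio 1 (M ℕ.+ M) * fromℕ 2       ≡⟨ solve 3 (λ a b c → ((a :* b) :* c) := (b :* (c :* a))) refl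
                                                            (fromℕ M) (ratio 1 (M ℕ.+ M)) (fromℕ 2) ⟩
      ratio 1 (M ℕ.+ M) * (fromℕ 2 * fromℕ M)     ≡⟨ cong (ratio 1 (M ℕ.+ M) *_)
                                                          (trans (sym (fromℕ-* 2 M)) (cong (λ n → fromℕ (M ℕ.+ n)) (ℕ.+-identityʳ M))) ⟩
      ratio 1 (M ℕ.+ M) * fromℕ (M ℕ.+ M)         ≡⟨ ratio-*-fromℕ 1 (M ℕ.+ M) ⟩
      1ℚ                                          ∎)

  j*½≤harmonic[2^j] : ∀ j → fromℕ j * ½ ≤ harmonic (2 ℕ.^ j)
  j*½≤harmonic[2^j] zero    = subst (_≤ harmonic 1) (sym (ℚ.*-zeroˡ ½)) (harmonic-mono {0} {1} z≤n)
  j*½≤harmonic[2^j] (suc j) = begin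
    fromℕ (suc j) * ½                        ≡⟨ cong (_* ½) (fromℕ-suc j) ⟩
    (fromℕ j + 1ℚ) * ½                       ≡⟨ trans (ℚ.*-distribʳ-+ ½ (fromℕ j) 1ℚ) (cong (λ x → fromℕ j * ½ + x) (ℚ.*-identityˡ ½)) ⟩
    fromℕ j * ½ + ½                          ≤⟨ ℚ.+-mono-≤ (j*½≤harmonic[2^j] j) (½≤harmonic-block M) ⟩
    harmonic M + sumℚ (map (λ i → ratio 1 (suc i)) (applyUpTo (λ i → M ℕ.+ i) M)) ≡⟨ harmonic-+ M M ⟨
    harmonic (M ℕ.+ M)                       ≡⟨ cong (λ n → harmonic (M ℕ.+ n)) (ℕ.+-identityʳ M) ⟨
    harmonic (2 ℕ.^ suc j)                   ∎
    where
    open ℚ.≤-Reasoning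
    M = 2 ℕ.^ j
    instance _ = ℕ.m^n≢0 2 j

  eulerProduct≤2/j : ∀ j P .{{_ : NonZero j}} → 2 ℕ.^ j ℕ.≤ P → eulerProduct 1 (primesUpTo P) ≤ fromℕ 2 * ratio 1 j
  eulerProduct≤2/j j P 2^j≤P = begin
    F                                                     ≡⟨ ℚ.*-identityʳ F ⟨
    F * 1ℚ                                                ≡⟨ cong (F *_) j/2*2/j≡1 ⟨
    F * ((fromℕ j * ½) * (fromℕ 2 * ratio 1 j))           ≡⟨ ℚ.*-assoc F _ _ ⟨
    (F * (fromℕ j * ½)) * (fromℕ 2 * ratio 1 j)           ≤⟨ *-monoˡ-≤-0≤ (0≤* (0≤fromℕ 2) (0≤ratio 1 j)) F*j/2≤1 ⟩
    1ℚ * (fromℕ 2 * ratio 1 j)                            ≡⟨ ℚ.*-identityˡ _ ⟩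
    fromℕ 2 * ratio 1 j                                   ∎
    where
    open ℚ.≤-Reasoning
    F = eulerProduct 1 (primesUpTo P)
    F*j/2≤1 : F * (fromℕ j * ½) ≤ 1ℚ
    F*j/2≤1 = ℚ.≤-trans (*-monoʳ-≤-0≤ (0≤eulerProduct 1 (primesUpTo P)) (ℚ.≤-trans (j*½≤harmonic[2^j] j) (harmonic-mono 2^j≤P)))
                        (subst (_≤ 1ℚ) (ℚ.*-comm (harmonic P) F) (harmonic*eulerProduct≤1 P))
    j/2*2/j≡1 : (fromℕ j * ½) * (fromℕ 2 * ratio 1 j) ≡ 1ℚ
    j/2*2/j≡1 = begin-equality
      (fromℕ j * ½) * (fromℕ 2 * ratio 1 j)               ≡⟨ solve 4 (λ a b c d → ((a :* b) :* (c :* d)) := ((a :* d) :* (b :* c))) refl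
                                                                   (fromℕ j) ½ (fromℕ 2) (ratio 1 j) ⟩
      (fromℕ j * ratio 1 j) * (½ * fromℕ 2)               ≡⟨ cong₂ _*_ (fromℕ-*-ratio1 j) (ratio-*-fromℕ 1 2) ⟩
      1ℚ * 1ℚ                                             ≡⟨ ℚ.*-identityˡ 1ℚ ⟩
      1ℚ                                                  ∎

  densityConverges-b≡0-n≡2 : DensityConverges 2 (+ 0)
  densityConverges-b≡0-n≡2 ε 0<ε =
    let R , invWidth-small = invWidth⟶0 (ε * ½ * ½) (0<ε⇒0<ε*½ (0<ε⇒0<ε*½ 0<ε))
        j , 2≤j , 2/j<ε/2 = archimedean-ratio 2 (ε * ½) (0<ε⇒0<ε*½ 0<ε)
        instance _ = ℕ.>-nonZero (ℕ.<-≤-trans (s≤s z≤n) 2≤j)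
    in R , 2 ℕ.^ j , λ r P′ R≤r 2^j≤P′ →
      let V = visibleDensity 1 (+ 0) r
          F = eulerProduct 1 (primesUpTo P′)
          0≤V = 0≤* (0≤fromℕ (visibleCount 1 (+ 0) r)) (0≤^ 1 (0≤invWidth r))
          V<ε/2 = begin-strict
            V                            ≡⟨ cong (fromℕ (visibleCount 1 (+ 0) r) *_) (ℚ.*-identityʳ (invWidth r)) ⟩
            fromℕ (visibleCount 1 (+ 0) r) * invWidth r
                                         ≤⟨ *-monoˡ-≤-0≤ (0≤invWidth r) (fromℕ-mono-≤ (visibleCount-line≤2 r)) ⟩
            fromℕ 2 * invWidth r         <⟨ *-monoʳ-<-0< (0<fromℕ 2) (subst (_< ε * ½ * ½) (ℚ.+-identityʳ (invWidth r))
                                                                         (ℚ.≤-<-trans (p≤∣p∣ _) (invWidth-small r R≤r))) ⟩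
            fromℕ 2 * (ε * ½ * ½)        ≡⟨ solve 3 (λ a b c → (a :* (b :* c)) := (b :* (a :* c))) refl (fromℕ 2) (ε * ½) ½ ⟩
            ε * ½ * (fromℕ 2 * ½)        ≡⟨ cong (ε * ½ *_) (trans (ℚ.*-comm (fromℕ 2) ½) (ratio-*-fromℕ 1 2)) ⟩
            ε * ½ * 1ℚ                   ≡⟨ ℚ.*-identityʳ (ε * ½) ⟩
            ε * ½                        ∎
      in subst (λ x → ∣ x - F ∣ < ε) (sym (densityRatio≡visibleDensity 1 (+ 0) r z≤n)) (begin-strict
        ∣ V - F ∣              ≤⟨ ℚ.∣p-q∣≤∣p∣+∣q∣ V F ⟩
        ∣ V ∣ + ∣ F ∣          ≡⟨ cong₂ _+_ (ℚ.0≤p⇒∣p∣≡p 0≤V) (ℚ.0≤p⇒∣p∣≡p (0≤eulerProduct 1 (primesUpTo P′))) ⟩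
        V + F                  <⟨ ℚ.+-mono-<-≤ V<ε/2 (ℚ.≤-trans (eulerProduct≤2/j j P′ 2^j≤P′) (ℚ.<⇒≤ 2/j<ε/2)) ⟩
        ε * ½ + ε * ½          ≡⟨ ε*½+ε*½≡ε ε ⟩
        ε                      ∎)
    where open ℚ.≤-Reasoning

open Hyperplane using (DensityConverges)
open NonzeroOffset using (densityConverges-b≢0)
open ZeroOffset using (densityConverges-b≡0-n≥3)
open ZeroOffsetLine using (densityConverges-b≡0-n≡2)
open import Defs
open import Data.Nat using (ℕ; suc; _≤_; s≤s; _≟_)
open import Data.Nat.Properties using (m≤n⇒m<n∨m≡n)
open import Data.Integer as ℤ using (ℤ)
open import Data.Integer.Properties using (∣i∣≡0⇒i≡0)
open import Data.Rational using (ℚ; 0ℚ; _<_; _-_; ∣_∣)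
open import Data.Product using (Σ)
open import Data.Sum using (inj₁; inj₂)
open import Relation.Binary.PropositionalEquality using (refl; sym; subst)
open import Relation.Nullary using (yes; no)

lemma3p1 : (n : ℕ) → 2 ≤ n → (b : ℤ) →
    (ε : ℚ) → 0ℚ < ε →
    Σ ℕ (λ R → Σ ℕ (λ P → (r P′ : ℕ) → R ≤ r → P ≤ P′ →
      ∣ densityRatio n b r - partialProduct n b P′ ∣ < ε))
lemma3p1 (suc m) (s≤s 1≤m) b with ℤ.∣ b ∣ ≟ 0 | m≤n⇒m<n∨m≡n 1≤m
... | no  b≢0 | _         = densityConverges-b≢0 m b b≢0
... | yes b≡0 | inj₁ 2≤m  = subst (DensityConverges (suc m)) (sym (∣i∣≡0⇒i≡0 b≡0)) (densityConverges-b≡0-n≥3 m 2≤m)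
... | yes b≡0 | inj₂ refl = subst (DensityConverges 2) (sym (∣i∣≡0⇒i≡0 b≡0)) densityConverges-b≡0-n≡2
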